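{- The sequences $(a_n)=\left(\frac{1}{2^n}\right)$ and $(b_n)=\left(*+(\uparrow\!*)\times n\right)$ of games in $\mathcal{C}$ are Cauchy under $wd$.
   Context: $\mathcal{C}$ denotes the set of all short combinatorial games (normal play) in canonical form. Here $\frac{1}{2^n}$ is the dyadic number game, $*=\{0|0\}$, $\uparrow=\{0|*\}$, $\uparrow\!*=\uparrow+*$, and $(\uparrow\!*)\times n$ is the disjunctive sum of $n$ copies of $\uparrow\!*$. For $G\in\mathcal{C}$, $D(G)$ is the bicolored (blue = Left, red = Right) DAG of $G$ obtained from its game tree by identifying nodes representing the same game; it has a single source $G$ and single sink $0$. An edit sequence from $G$ to $H$ is a sequence of colored edge removals/additions turning $D(G)$ into a colored DAG isomorphic to $D(H)$ without changing the source; isolated vertices are removed. An edit costs $(1/2)^d$, where $d$ is the distance from the source to the initial node of the edited edge. $wd(G,H)$ is the minimum total cost over all edit sequences. A sequence $(g_n)$ is Cauchy under $wd$ if for every $\epsilon>0$ there is $N$ such that $wd(g_n,g_m)<\epsilon$ for all $n,m>N$.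
   Formalization: The bound ε in the Cauchy condition under wd ranges over the positive rationals. -}

module Defs where

open import Data.Nat using (ℕ; zero; suc; _≤_)
open import Data.Fin using (Fin)
open import Data.List using (List; []; _∷_; _++_; length; lookup)
open import Data.List.Membership.Propositional using (_∈_)
open import Data.Product using (Σ; ∃; _×_; _,_)
open import Data.Sum using (_⊎_)
open import Data.Unit using (⊤)
open import Relation.Nullary using (¬_)
open import Relation.Binary.PropositionalEquality using (_≡_; _≢_)
open import Data.Rational using (ℚ; 0ℚ; 1ℚ; ½) renaming (_+_ to _+ℚ_; _*_ to _*ℚ_; _<_ to _<ℚ_)

data Game : Set where
  ⟨_∣_⟩ : List Game → List Game → Game

lefts : Game → List Game
lefts ⟨ L ∣ R ⟩ = L

rights : Game → List Game
rights ⟨ L ∣ R ⟩ = R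

mutual
  _≤g_ : Game → Game → Set
  ⟨ GL ∣ GR ⟩ ≤g ⟨ HL ∣ HR ⟩ = noLeftAbove GL ⟨ HL ∣ HR ⟩ × noRightBelow HR ⟨ GL ∣ GR ⟩

  noLeftAbove : List Game → Game → Set
  noLeftAbove [] H = ⊤
  noLeftAbove (g ∷ gs) H = ¬ (H ≤g g) × noLeftAbove gs H

  noRightBelow : List Game → Game → Set
  noRightBelow [] G = ⊤
  noRightBelow (h ∷ hs) G = ¬ (h ≤g G) × noRightBelow hs G

_≈g_ : Game → Game → Set
G ≈g H = (G ≤g H) × (H ≤g G)

-- disjunctive sum  G + H = { G^L + H , G + H^L | G^R + H , G + H^R }
mutual
  _⊕_ : Game → Game → Game
  ⟨ GL ∣ GR ⟩ ⊕ ⟨ HL ∣ HR ⟩ =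
    ⟨ addR GL ⟨ HL ∣ HR ⟩ ++ addL ⟨ GL ∣ GR ⟩ HL
    ∣ addR GR ⟨ HL ∣ HR ⟩ ++ addL ⟨ GL ∣ GR ⟩ HR ⟩

  addR : List Game → Game → List Game
  addR [] H = []
  addR (g ∷ gs) H = (g ⊕ H) ∷ addR gs H

  addL : Game → List Game → List Game
  addL G [] = []
  addL G (h ∷ hs) = (G ⊕ h) ∷ addL G hs

-- Canonical form: options canonical, no dominated options (in particular
-- no duplicates), no reversible options.
data Canonical : Game → Set where
  canon : ∀ {L R} →
    (∀ x → x ∈ L → Canonical x) →
    (∀ x → x ∈ R → Canonical x) →
    (∀ (i j : Fin (length L)) → i ≢ j → ¬ (lookup L i ≤g lookup L j)) →
    (∀ (i j : Fin (length R)) → i ≢ j → ¬ (lookup R i ≤g lookup R j)) →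
    (∀ x → x ∈ L → ∀ y → y ∈ rights x → ¬ (y ≤g ⟨ L ∣ R ⟩)) →
    (∀ x → x ∈ R → ∀ y → y ∈ lefts x → ¬ (⟨ L ∣ R ⟩ ≤g y)) →
    Canonical ⟨ L ∣ R ⟩

zeroG : Game
zeroG = ⟨ [] ∣ [] ⟩

oneG : Game
oneG = ⟨ zeroG ∷ [] ∣ [] ⟩

star : Game
star = ⟨ zeroG ∷ [] ∣ zeroG ∷ [] ⟩

up : Game
up = ⟨ zeroG ∷ [] ∣ star ∷ [] ⟩

upStar : Game
upStar = up ⊕ star

-- 1/2^n in canonical form:  1/2^0 = 1 = {0|},  1/2^(n+1) = {0 | 1/2^n}
dyadic : ℕ → Game
dyadic zero = oneG
dyadic (suc n) = ⟨ zeroG ∷ [] ∣ dyadic n ∷ [] ⟩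

upStarTimes : ℕ → Game
upStarTimes zero = zeroG
upStarTimes (suc n) = upStar ⊕ upStarTimes n

data Color : Set where
  blue red : Color

-- colored edge set: E c u v  means a c-colored edge u → v
EdgeSet : Set₁
EdgeSet = Color → Game → Game → Set

data Sub (G : Game) : Game → Set where
  self : Sub G G
  viaL : ∀ {u v} → Sub G u → v ∈ lefts u → Sub G v
  viaR : ∀ {u v} → Sub G u → v ∈ rights u → Sub G v

-- edges of D(G): blue u → v if v is a Left option of subposition u,
-- red u → v if v is a Right option.  Nodes are games, so nodes representing
-- the same game are identified.
DE : Game → EdgeSet
DE G blue u v = Sub G u × (v ∈ lefts u)
DE G red  u v = Sub G u × (v ∈ rights u)

data Path (E : EdgeSet) (s : Game) : Game → ℕ → Set where
  here : Path E s s zero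
  step : ∀ {c u v n} → Path E s u n → E c u v → Path E s v (suc n)

Dist : EdgeSet → Game → Game → ℕ → Set
Dist E s v d = Path E s v d × (∀ m → Path E s v m → d ≤ m)

addE : EdgeSet → Color → Game → Game → EdgeSet
addE E c u v c' x y = E c' x y ⊎ ((c' ≡ c) × (x ≡ u) × (y ≡ v))

remE : EdgeSet → Color → Game → Game → EdgeSet
remE E c u v c' x y = E c' x y × ¬ ((c' ≡ c) × (x ≡ u) × (y ≡ v))

half^ : ℕ → ℚ
half^ zero = 1ℚ
half^ (suc d) = ½ *ℚ half^ d

-- Edits s E F q : a sequence of single colored-edge additions/removals,
-- with source s, turning E into F, of total cost q; each edit costs (1/2)^d
-- with d the distance (in the current graph) from the source to the initial
-- node of the edited edge.
data Edits (s : Game) : EdgeSet → EdgeSet → ℚ → Set₁ where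
  done : ∀ {E} → Edits s E E 0ℚ
  add  : ∀ {E F q c u v d} → ¬ E c u v → Dist E s u d →
         Edits s (addE E c u v) F q → Edits s E F (half^ d +ℚ q)
  rem  : ∀ {E F q c u v d} → E c u v → Dist E s u d →
         Edits s (remE E c u v) F q → Edits s E F (half^ d +ℚ q)

-- vertices of a graph with source s (isolated vertices other than the
-- source are removed)
Vert : EdgeSet → Game → Game → Set
Vert E s v = (v ≡ s) ⊎ (∃ λ c → ∃ λ w → E c v w ⊎ E c w v)

Iso : EdgeSet → Game → EdgeSet → Game → Set
Iso E s F t = Σ (Game → Game) λ f →
    (f s ≡ t)
  × (∀ x y → Vert E s x → Vert E s y → f x ≡ f y → x ≡ y)
  × (∀ c x y → E c x y → F c (f x) (f y))
  × (∀ c x' y' → F c x' y' → ∃ λ x → ∃ λ y → E c x y × (f x ≡ x') × (f y ≡ y'))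

-- wd(G,H) < ε : some edit sequence from D(G) to a graph isomorphic to D(H)
-- has total cost < ε  (wd is the minimum over such sequences)
WdLt : Game → Game → ℚ → Set₁
WdLt G H ε = ∃ λ (F : EdgeSet) → ∃ λ q →
  Edits G (DE G) F q × Iso F G (DE H) H × (q <ℚ ε)

Cauchy : (ℕ → Game) → Set₁
Cauchy g = ∀ (ε : ℚ) → 0ℚ <ℚ ε → ∃ λ N → ∀ n m → N Data.Nat.< n → N Data.Nat.< m →
  WdLt (g n) (g m) ε

IsCanonSeqB : (ℕ → Game) → Set
IsCanonSeqB b = ∀ n → Canonical (b n) × (b n ≈g (star ⊕ upStarTimes n))

{-# OPTIONS --safe #-}
-- Both sequences are chains c n = {0 | c (n - 1)} over c 0 = {0 |} = 1, resp. c 0 = {0 | 0} = *;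
-- for * + (↑*)·n the chain is the canonical form, which is unique.  D(c n) is the red path
-- c n → ⋯ → c 0 (followed by c 0 → 0 for *) with a blue edge from every c j to 0.  For n < m it
-- becomes a copy of D(c m) by cutting the edge c 1 → c 0 and inserting m - n fresh nodes below
-- c 1; for n > m by adding a shortcut c (n - m + 1) → c 0 and deleting c 1, …, c (n - m).
-- Every edited edge starts at depth at least d = min n m - 1, with two edits at depth d and at
-- most two at each greater depth, so the cost is at most 4 · (1/2)^d, which tends to 0.
module Submission where

open import Defs
open import Data.Bool using (Bool; true; false)
open import Data.Empty using (⊥; ⊥-elim)
open import Function using (_∘_)
open import Data.Fin using (Fin) renaming (zero to fzero; suc to fsuc)
import Data.Fin.Properties as Finₚ
open import Data.List using (List; []; _∷_; length; lookup)
open import Data.List.Membership.Propositional using (_∈_)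
open import Data.List.Membership.Propositional.Properties using (∈-++⁺ˡ; ∈-++⁺ʳ; ∈-++⁻)
open import Data.List.Relation.Unary.Any using (here; there; index)
open import Data.List.Relation.Unary.Any.Properties using (lookup-index)
open import Data.Nat using (ℕ; zero; suc; _+_; _*_; _∸_; _^_; _≤_; _<_; z≤n; s≤s; _≤?_)
import Data.Nat.Properties as ℕₚ
import Data.Integer as ℤ
open import Data.Integer using (+[1+_])
import Data.Integer.Properties as ℤₚ
import Data.Rational as ℚ
open import Data.Rational using (ℚ; mkℚ; 0ℚ; 1ℚ; ½; toℚᵘ)
  renaming (_+_ to _+ℚ_; _*_ to _*ℚ_; _<_ to _<ℚ_; _≤_ to _≤ℚ_)
import Data.Rational.Properties as ℚₚ
open import Data.Rational.Solver using (module +-*-Solver)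
open +-*-Solver using (solve; _:+_; _:=_)
import Data.Rational.Unnormalised as ℚᵘ
import Data.Rational.Unnormalised.Properties as ℚᵘₚ
open import Data.Product using (∃; _×_; _,_; proj₁; proj₂)
open import Data.Sum using (_⊎_; inj₁; inj₂)
open import Data.Unit using (tt)
open import Relation.Nullary using (¬_; Dec; yes; no; ¬?)
open import Relation.Nullary.Decidable using (_×-dec_; toWitness; toWitnessFalse)
open import Relation.Binary.Bundles using (Setoid)
open import Relation.Binary.Definitions using (tri<; tri≈; tri>)
import Relation.Binary.Reasoning.Setoid as SetoidReasoning
open import Relation.Binary.PropositionalEquality using (module ≡-Reasoning; _≡_; _≢_; refl; sym; trans; cong; cong₂; subst; subst₂)

-- The order on games

data Side : Set where
  left right : Side

opts : Side → Game → List Game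
opts left  = lefts
opts right = rights

noLeftAbove-∈ : ∀ {L H g} → noLeftAbove L H → g ∈ L → ¬ (H ≤g g)
noLeftAbove-∈ (H≰g , _) (here refl) = H≰g
noLeftAbove-∈ (_ , rest) (there g∈L) = noLeftAbove-∈ rest g∈L

noLeftAbove-intro : ∀ {L H} → (∀ {g} → g ∈ L → ¬ (H ≤g g)) → noLeftAbove L H
noLeftAbove-intro {[]}    f = tt
noLeftAbove-intro {_ ∷ L} f = f (here refl) , noLeftAbove-intro (λ g∈L → f (there g∈L))

noRightBelow-∈ : ∀ {L G h} → noRightBelow L G → h ∈ L → ¬ (h ≤g G)
noRightBelow-∈ (h≰G , _) (here refl) = h≰G
noRightBelow-∈ (_ , rest) (there h∈L) = noRightBelow-∈ rest h∈L

noRightBelow-intro : ∀ {L G} → (∀ {h} → h ∈ L → ¬ (h ≤g G)) → noRightBelow L G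
noRightBelow-intro {[]}    f = tt
noRightBelow-intro {_ ∷ L} f = f (here refl) , noRightBelow-intro (λ h∈L → f (there h∈L))

≤g-intro : ∀ {G H} → (∀ {g} → g ∈ lefts G → ¬ (H ≤g g)) →
           (∀ {h} → h ∈ rights H → ¬ (h ≤g G)) → G ≤g H
≤g-intro {⟨ _ ∣ _ ⟩} {⟨ _ ∣ _ ⟩} f k = noLeftAbove-intro f , noRightBelow-intro k

≤g-leftOpt : ∀ {G H g} → G ≤g H → g ∈ lefts G → ¬ (H ≤g g)
≤g-leftOpt {⟨ _ ∣ _ ⟩} {⟨ _ ∣ _ ⟩} (p , _) = noLeftAbove-∈ p

≤g-rightOpt : ∀ {G H h} → G ≤g H → h ∈ rights H → ¬ (h ≤g G)
≤g-rightOpt {⟨ _ ∣ _ ⟩} {⟨ _ ∣ _ ⟩} (_ , q) = noRightBelow-∈ q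

mutual
  _≤g?_ : ∀ G H → Dec (G ≤g H)
  ⟨ GL ∣ GR ⟩ ≤g? ⟨ HL ∣ HR ⟩ = noLeftAbove? GL ⟨ HL ∣ HR ⟩ ×-dec noRightBelow? HR ⟨ GL ∣ GR ⟩

  noLeftAbove? : ∀ L H → Dec (noLeftAbove L H)
  noLeftAbove? []      H = yes tt
  noLeftAbove? (g ∷ L) H = ¬? (H ≤g? g) ×-dec noLeftAbove? L H

  noRightBelow? : ∀ L G → Dec (noRightBelow L G)
  noRightBelow? []      G = yes tt
  noRightBelow? (h ∷ L) G = ¬? (h ≤g? G) ×-dec noRightBelow? L G

¬noLeftAbove⇒∃ : ∀ L H → ¬ noLeftAbove L H → ∃ λ g → g ∈ L × H ≤g g
¬noLeftAbove⇒∃ []      H ¬p = ⊥-elim (¬p tt)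
¬noLeftAbove⇒∃ (g ∷ L) H ¬p with H ≤g? g
... | yes H≤g = g , here refl , H≤g
... | no  H≰g with ¬noLeftAbove⇒∃ L H (λ p → ¬p (H≰g , p))
...   | g′ , g′∈L , H≤g′ = g′ , there g′∈L , H≤g′

¬noRightBelow⇒∃ : ∀ L G → ¬ noRightBelow L G → ∃ λ h → h ∈ L × h ≤g G
¬noRightBelow⇒∃ []      G ¬p = ⊥-elim (¬p tt)
¬noRightBelow⇒∃ (h ∷ L) G ¬p with h ≤g? G
... | yes h≤G = h , here refl , h≤G
... | no  h≰G with ¬noRightBelow⇒∃ L G (λ p → ¬p (h≰G , p))
...   | h′ , h′∈L , h′≤G = h′ , there h′∈L , h′≤G

≰g⇒∃ : ∀ G H → ¬ (G ≤g H) →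
       (∃ λ g → g ∈ lefts G × H ≤g g) ⊎ (∃ λ h → h ∈ rights H × h ≤g G)
≰g⇒∃ ⟨ GL ∣ GR ⟩ ⟨ HL ∣ HR ⟩ G≰H with noLeftAbove? GL ⟨ HL ∣ HR ⟩
... | no  ¬p = inj₁ (¬noLeftAbove⇒∃ GL _ ¬p)
... | yes p  = inj₂ (¬noRightBelow⇒∃ HR _ (λ q → G≰H (p , q)))

mutual
  ≤g-refl : ∀ G → G ≤g G
  ≤g-refl ⟨ L ∣ R ⟩ = ≤g-intro (λ g∈L G≤g → ≤g-leftOpt G≤g g∈L (≤g-refl-∈ L g∈L))
                               (λ h∈R h≤G → ≤g-rightOpt h≤G h∈R (≤g-refl-∈ R h∈R))

  ≤g-refl-∈ : ∀ L {g} → g ∈ L → g ≤g g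
  ≤g-refl-∈ (g ∷ _) (here refl) = ≤g-refl g
  ≤g-refl-∈ (_ ∷ L) (there g∈L) = ≤g-refl-∈ L g∈L

≰leftOpt : ∀ {G g} → g ∈ lefts G → ¬ (G ≤g g)
≰leftOpt g∈GL G≤g = ≤g-leftOpt G≤g g∈GL (≤g-refl _)

rightOpt≰ : ∀ {G h} → h ∈ rights G → ¬ (h ≤g G)
rightOpt≰ h∈GR h≤G = ≤g-rightOpt h≤G h∈GR (≤g-refl _)

≰g-byLeftOpt : ∀ G H {g} → g ∈ lefts G → H ≤g g → ¬ (G ≤g H)
≰g-byLeftOpt _ _ g∈GL H≤g G≤H = ≤g-leftOpt G≤H g∈GL H≤g

≰g-byRightOpt : ∀ G H {h} → h ∈ rights H → h ≤g G → ¬ (G ≤g H)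
≰g-byRightOpt _ _ h∈HR h≤G G≤H = ≤g-rightOpt G≤H h∈HR h≤G

mutual
  size : Game → ℕ
  size ⟨ L ∣ R ⟩ = suc (sizes L + sizes R)

  sizes : List Game → ℕ
  sizes []      = 0
  sizes (g ∷ L) = size g + sizes L

size≤sizes : ∀ {g L} → g ∈ L → size g ≤ sizes L
size≤sizes {L = g ∷ L} (here refl) = ℕₚ.m≤m+n (size g) (sizes L)
size≤sizes {L = x ∷ L} (there g∈L) = ℕₚ.≤-trans (size≤sizes g∈L) (ℕₚ.m≤n+m (sizes L) (size x))

size-opt : ∀ s {G g} → g ∈ opts s G → size g < size G
size-opt left  {⟨ L ∣ R ⟩} g∈L = s≤s (ℕₚ.≤-trans (size≤sizes g∈L) (ℕₚ.m≤m+n (sizes L) (sizes R)))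
size-opt right {⟨ L ∣ R ⟩} g∈R = s≤s (ℕₚ.≤-trans (size≤sizes g∈R) (ℕₚ.m≤n+m (sizes R) (sizes L)))

module _ {n : ℕ} where

  shrinkˡ : ∀ {a A B} → a < A → A + B ≤ suc n → a + B ≤ n
  shrinkˡ {B = B} a<A bound = ℕₚ.≤-pred (ℕₚ.<-≤-trans (ℕₚ.+-monoˡ-< B a<A) bound)

  shrinkʳ : ∀ {b A B} → b < B → A + B ≤ suc n → A + b ≤ n
  shrinkʳ {A = A} b<B bound = ℕₚ.≤-pred (ℕₚ.<-≤-trans (ℕₚ.+-monoʳ-< A b<B) bound)

  shrink₁ : ∀ {a A B C} → a < A → A + B + C ≤ suc n → a + B + C ≤ n
  shrink₁ {B = B} a<A = shrinkˡ (ℕₚ.+-monoˡ-< B a<A)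

  shrink₂ : ∀ {b A B C} → b < B → A + B + C ≤ suc n → A + b + C ≤ n
  shrink₂ {A = A} b<B = shrinkˡ (ℕₚ.+-monoʳ-< A b<B)

  shrink₃ : ∀ {c A B C} → c < C → A + B + C ≤ suc n → A + B + c ≤ n
  shrink₃ {A = A} {B} = shrinkʳ {A = A + B}

  shrink₁-rotate : ∀ {a A B C} → a < A → A + B + C ≤ suc n → B + C + a ≤ n
  shrink₁-rotate {a} {B = B} {C} a<A bound =
    subst (_≤ n) (trans (ℕₚ.+-assoc a B C) (ℕₚ.+-comm a (B + C))) (shrink₁ a<A bound)

  shrink₃-rotate : ∀ {c A B C} → c < C → A + B + C ≤ suc n → c + A + B ≤ n
  shrink₃-rotate {c} {A} {B} c<C bound =
    subst (_≤ n) (sym (trans (ℕₚ.+-assoc c A B) (ℕₚ.+-comm c (A + B)))) (shrink₃ {A = A} {B} c<C bound)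

≤g-trans-fuel : ∀ n G H K → size G + size H + size K ≤ n → G ≤g H → H ≤g K → G ≤g K
≤g-trans-fuel zero    ⟨ _ ∣ _ ⟩ _ _ ()
≤g-trans-fuel (suc n) G H K bound G≤H H≤K = ≤g-intro
  (λ g∈GL K≤g → ≤g-leftOpt G≤H g∈GL
    (≤g-trans-fuel n H K _ (shrink₁-rotate {A = size G} (size-opt left {G} g∈GL) bound) H≤K K≤g))
  (λ k∈KR k≤G → ≤g-rightOpt H≤K k∈KR
    (≤g-trans-fuel n _ G H (shrink₃-rotate {A = size G} {size H} (size-opt right {K} k∈KR) bound) k≤G G≤H))

≤g-trans : ∀ {G H K} → G ≤g H → H ≤g K → G ≤g K
≤g-trans = ≤g-trans-fuel _ _ _ _ ℕₚ.≤-refl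

≈g-refl : ∀ {G} → G ≈g G
≈g-refl = ≤g-refl _ , ≤g-refl _

≈g-sym : ∀ {G H} → G ≈g H → H ≈g G
≈g-sym (G≤H , H≤G) = H≤G , G≤H

≈g-trans : ∀ {G H K} → G ≈g H → H ≈g K → G ≈g K
≈g-trans (G≤H , H≤G) (H≤K , K≤H) = ≤g-trans G≤H H≤K , ≤g-trans K≤H H≤G

≰g-respʳ-≈g : ∀ {G H H′} → ¬ (G ≤g H) → H′ ≈g H → ¬ (G ≤g H′)
≰g-respʳ-≈g G≰H (H′≤H , _) G≤H′ = G≰H (≤g-trans G≤H′ H′≤H)

≈g-setoid : Setoid _ _
≈g-setoid = record
  { Carrier = Game
  ; _≈_ = _≈g_
  ; isEquivalence = record { refl = ≈g-refl ; sym = ≈g-sym ; trans = ≈g-trans }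
  }

module ≈g-Reasoning = SetoidReasoning ≈g-setoid

≤g-byMatching : ∀ {G H} →
  (∀ {g} → g ∈ lefts G → ∃ λ h → h ∈ lefts H × g ≤g h) →
  (∀ {h} → h ∈ rights H → ∃ λ g → g ∈ rights G × g ≤g h) → G ≤g H
≤g-byMatching matchL matchR = ≤g-intro
  (λ g∈GL H≤g → let (h , h∈HL , g≤h) = matchL g∈GL in ≰leftOpt h∈HL (≤g-trans H≤g g≤h))
  (λ h∈HR h≤G → let (g , g∈GR , g≤h) = matchR h∈HR in rightOpt≰ g∈GR (≤g-trans g≤h h≤G))

OptionsCovered : Game → Game → Set
OptionsCovered G H = ∀ s {x} → x ∈ opts s G → ∃ λ y → y ∈ opts s H × x ≈g y

≈g-byCovering : ∀ {G H} → OptionsCovered G H → OptionsCovered H G → G ≈g H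
≈g-byCovering G⊑H H⊑G =
  ≤g-byMatching (λ g∈ → let (h , h∈ , g≈h) = G⊑H left g∈ in h , h∈ , proj₁ g≈h)
                (λ h∈ → let (g , g∈ , h≈g) = H⊑G right h∈ in g , g∈ , proj₂ h≈g) ,
  ≤g-byMatching (λ h∈ → let (g , g∈ , h≈g) = H⊑G left h∈ in g , g∈ , proj₁ h≈g)
                (λ g∈ → let (h , h∈ , g≈h) = G⊑H right g∈ in h , h∈ , proj₂ g≈h)

-- Disjunctive sums

∈-addR : ∀ {g L H} → g ∈ L → g ⊕ H ∈ addR L H
∈-addR (here refl)  = here refl
∈-addR (there g∈L) = there (∈-addR g∈L)

∈-addL : ∀ {h L G} → h ∈ L → G ⊕ h ∈ addL G L
∈-addL (here refl)  = here refl
∈-addL (there h∈L) = there (∈-addL h∈L)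

∈-addR⁻ : ∀ {x L H} → x ∈ addR L H → ∃ λ g → g ∈ L × x ≡ g ⊕ H
∈-addR⁻ {L = g ∷ L} (here refl) = g , here refl , refl
∈-addR⁻ {L = g ∷ L} (there x∈) with ∈-addR⁻ x∈
... | g′ , g′∈L , refl = g′ , there g′∈L , refl

∈-addL⁻ : ∀ {x L G} → x ∈ addL G L → ∃ λ h → h ∈ L × x ≡ G ⊕ h
∈-addL⁻ {L = h ∷ L} (here refl) = h , here refl , refl
∈-addL⁻ {L = h ∷ L} (there x∈) with ∈-addL⁻ x∈
... | h′ , h′∈L , refl = h′ , there h′∈L , refl

⊕-optˡ : ∀ s {G H g} → g ∈ opts s G → g ⊕ H ∈ opts s (G ⊕ H)
⊕-optˡ left  {⟨ _ ∣ _ ⟩} {⟨ _ ∣ _ ⟩} g∈ = ∈-++⁺ˡ (∈-addR g∈)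
⊕-optˡ right {⟨ _ ∣ _ ⟩} {⟨ _ ∣ _ ⟩} g∈ = ∈-++⁺ˡ (∈-addR g∈)

⊕-optʳ : ∀ s {G H h} → h ∈ opts s H → G ⊕ h ∈ opts s (G ⊕ H)
⊕-optʳ left  {⟨ GL ∣ _ ⟩} {⟨ _ ∣ _ ⟩} h∈ = ∈-++⁺ʳ (addR GL _) (∈-addL h∈)
⊕-optʳ right {⟨ _ ∣ GR ⟩} {⟨ _ ∣ _ ⟩} h∈ = ∈-++⁺ʳ (addR GR _) (∈-addL h∈)

⊕-opt⁻ : ∀ s {G H x} → x ∈ opts s (G ⊕ H) →
  (∃ λ g → g ∈ opts s G × x ≡ g ⊕ H) ⊎ (∃ λ h → h ∈ opts s H × x ≡ G ⊕ h)
⊕-opt⁻ left {⟨ GL ∣ _ ⟩} {⟨ _ ∣ _ ⟩} x∈ with ∈-++⁻ (addR GL _) x∈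
... | inj₁ x∈ˡ = inj₁ (∈-addR⁻ x∈ˡ)
... | inj₂ x∈ʳ = inj₂ (∈-addL⁻ x∈ʳ)
⊕-opt⁻ right {⟨ _ ∣ GR ⟩} {⟨ _ ∣ _ ⟩} x∈ with ∈-++⁻ (addR GR _) x∈
... | inj₁ x∈ˡ = inj₁ (∈-addR⁻ x∈ˡ)
... | inj₂ x∈ʳ = inj₂ (∈-addL⁻ x∈ʳ)

⊕-comm-fuel : ∀ n G H → size G + size H ≤ n → (G ⊕ H) ≈g (H ⊕ G)
⊕-comm-fuel zero    ⟨ _ ∣ _ ⟩ _ ()
⊕-comm-fuel (suc n) G H bound =
  ≈g-byCovering (cover G H bound) (cover H G (subst (_≤ suc n) (ℕₚ.+-comm (size G) (size H)) bound))
  where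
  cover : ∀ A B → size A + size B ≤ suc n → OptionsCovered (A ⊕ B) (B ⊕ A)
  cover A B bound′ s x∈ with ⊕-opt⁻ s {A} {B} x∈
  ... | inj₁ (a , a∈ , refl) =
    B ⊕ a , ⊕-optʳ s {B} a∈ , ⊕-comm-fuel n a B (shrinkˡ (size-opt s {A} a∈) bound′)
  ... | inj₂ (b , b∈ , refl) =
    b ⊕ A , ⊕-optˡ s {B} b∈ , ⊕-comm-fuel n A b (shrinkʳ {A = size A} (size-opt s {B} b∈) bound′)

⊕-comm : ∀ G H → (G ⊕ H) ≈g (H ⊕ G)
⊕-comm G H = ⊕-comm-fuel _ G H ℕₚ.≤-refl

⊕-assoc-fuel : ∀ n G H K → size G + size H + size K ≤ n → ((G ⊕ H) ⊕ K) ≈g (G ⊕ (H ⊕ K))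
⊕-assoc-fuel zero    ⟨ _ ∣ _ ⟩ _ _ ()
⊕-assoc-fuel (suc n) G H K bound = ≈g-byCovering forth back
  where
  IH₁ : ∀ s {a} → a ∈ opts s G → ((a ⊕ H) ⊕ K) ≈g (a ⊕ (H ⊕ K))
  IH₁ s a∈ = ⊕-assoc-fuel n _ H K (shrink₁ (size-opt s {G} a∈) bound)
  IH₂ : ∀ s {b} → b ∈ opts s H → ((G ⊕ b) ⊕ K) ≈g (G ⊕ (b ⊕ K))
  IH₂ s b∈ = ⊕-assoc-fuel n G _ K (shrink₂ {A = size G} (size-opt s {H} b∈) bound)
  IH₃ : ∀ s {c} → c ∈ opts s K → ((G ⊕ H) ⊕ c) ≈g (G ⊕ (H ⊕ c))
  IH₃ s c∈ = ⊕-assoc-fuel n G H _ (shrink₃ {A = size G} {size H} (size-opt s {K} c∈) bound)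

  forth : OptionsCovered ((G ⊕ H) ⊕ K) (G ⊕ (H ⊕ K))
  forth s x∈ with ⊕-opt⁻ s {G ⊕ H} {K} x∈
  ... | inj₂ (c , c∈ , refl) = _ , ⊕-optʳ s {G} (⊕-optʳ s {H} c∈) , IH₃ s c∈
  ... | inj₁ (y , y∈ , refl) with ⊕-opt⁻ s {G} {H} y∈
  ...   | inj₁ (a , a∈ , refl) = _ , ⊕-optˡ s {G} a∈ , IH₁ s a∈
  ...   | inj₂ (b , b∈ , refl) = _ , ⊕-optʳ s {G} (⊕-optˡ s {H} b∈) , IH₂ s b∈

  back : OptionsCovered (G ⊕ (H ⊕ K)) ((G ⊕ H) ⊕ K)
  back s x∈ with ⊕-opt⁻ s {G} {H ⊕ K} x∈
  ... | inj₁ (a , a∈ , refl) = _ , ⊕-optˡ s {G ⊕ H} (⊕-optˡ s {G} a∈) , ≈g-sym (IH₁ s a∈)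
  ... | inj₂ (z , z∈ , refl) with ⊕-opt⁻ s {H} {K} z∈
  ...   | inj₁ (b , b∈ , refl) = _ , ⊕-optˡ s {G ⊕ H} (⊕-optʳ s {G} b∈) , ≈g-sym (IH₂ s b∈)
  ...   | inj₂ (c , c∈ , refl) = _ , ⊕-optʳ s {G ⊕ H} c∈ , ≈g-sym (IH₃ s c∈)

⊕-assoc : ∀ G H K → ((G ⊕ H) ⊕ K) ≈g (G ⊕ (H ⊕ K))
⊕-assoc G H K = ⊕-assoc-fuel _ G H K ℕₚ.≤-refl

-- The bound for cancellation lists G′ before G, so that no recursive call permutes it.
mutual
  ⊕-monoˡ-fuel : ∀ n G G′ H → size G + size G′ + size H ≤ n → G ≤g G′ → (G ⊕ H) ≤g (G′ ⊕ H)
  ⊕-monoˡ-fuel zero    ⟨ _ ∣ _ ⟩ _ _ ()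
  ⊕-monoˡ-fuel (suc n) G G′ H bound G≤G′ = ≤g-intro noLeft noRight
    where
    noLeft : ∀ {x} → x ∈ lefts (G ⊕ H) → ¬ ((G′ ⊕ H) ≤g x)
    noLeft x∈ ≤x with ⊕-opt⁻ left {G} {H} x∈
    ... | inj₁ (g , g∈ , refl) =
      ≤g-leftOpt G≤G′ g∈ (⊕-cancelˡ-fuel n g G′ H (shrink₁ (size-opt left {G} g∈) bound) ≤x)
    ... | inj₂ (h , h∈ , refl) =
      ≰leftOpt (⊕-optʳ left {G′} h∈)
        (≤g-trans ≤x (⊕-monoˡ-fuel n G G′ h (shrink₃ {A = size G} {size G′} (size-opt left {H} h∈) bound)
                                     G≤G′))
    noRight : ∀ {y} → y ∈ rights (G′ ⊕ H) → ¬ (y ≤g (G ⊕ H))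
    noRight y∈ y≤ with ⊕-opt⁻ right {G′} {H} y∈
    ... | inj₁ (g′ , g′∈ , refl) =
      ≤g-rightOpt G≤G′ g′∈
        (⊕-cancelˡ-fuel n G g′ H (shrink₂ {A = size G} (size-opt right {G′} g′∈) bound) y≤)
    ... | inj₂ (h , h∈ , refl) =
      rightOpt≰ (⊕-optʳ right {G} h∈)
        (≤g-trans (⊕-monoˡ-fuel n G G′ h (shrink₃ {A = size G} {size G′} (size-opt right {H} h∈) bound)
                                 G≤G′) y≤)

  ⊕-cancelˡ-fuel : ∀ n G′ G H → size G′ + size G + size H ≤ n → (G ⊕ H) ≤g (G′ ⊕ H) → G ≤g G′
  ⊕-cancelˡ-fuel zero    ⟨ _ ∣ _ ⟩ _ _ ()
  ⊕-cancelˡ-fuel (suc n) G′ G H bound G⊕H≤G′⊕H = ≤g-intro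
    (λ g∈ G′≤g → ≤g-leftOpt G⊕H≤G′⊕H (⊕-optˡ left {G} g∈)
      (⊕-monoˡ-fuel n G′ _ H (shrink₂ {A = size G′} (size-opt left {G} g∈) bound) G′≤g))
    (λ g′∈ g′≤G → ≤g-rightOpt G⊕H≤G′⊕H (⊕-optˡ right {G′} g′∈)
      (⊕-monoˡ-fuel n _ G H (shrink₁ (size-opt right {G′} g′∈) bound) g′≤G))

⊕-monoˡ-≤g : ∀ {G G′} H → G ≤g G′ → (G ⊕ H) ≤g (G′ ⊕ H)
⊕-monoˡ-≤g {G} {G′} H = ⊕-monoˡ-fuel _ G G′ H ℕₚ.≤-refl

⊕-congˡ : ∀ {G G′} H → G ≈g G′ → (G ⊕ H) ≈g (G′ ⊕ H)
⊕-congˡ H (G≤G′ , G′≤G) = ⊕-monoˡ-≤g H G≤G′ , ⊕-monoˡ-≤g H G′≤G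

⊕-congʳ : ∀ G {H H′} → H ≈g H′ → (G ⊕ H) ≈g (G ⊕ H′)
⊕-congʳ G {H} {H′} H≈H′ = ≈g-trans (⊕-comm G H) (≈g-trans (⊕-congˡ G H≈H′) (⊕-comm H′ G))

⊕-identityʳ-fuel : ∀ n G → size G ≤ n → (G ⊕ zeroG) ≈g G
⊕-identityʳ-fuel zero    ⟨ _ ∣ _ ⟩ ()
⊕-identityʳ-fuel (suc n) G bound = ≈g-byCovering forth back
  where
  IH : ∀ s {g} → g ∈ opts s G → (g ⊕ zeroG) ≈g g
  IH s g∈ = ⊕-identityʳ-fuel n _ (ℕₚ.≤-pred (ℕₚ.<-≤-trans (size-opt s {G} g∈) bound))

  forth : OptionsCovered (G ⊕ zeroG) G
  forth s x∈ with ⊕-opt⁻ s {G} {zeroG} x∈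
  forth s x∈ | inj₁ (g , g∈ , refl) = g , g∈ , IH s g∈
  forth left  x∈ | inj₂ (_ , () , _)
  forth right x∈ | inj₂ (_ , () , _)

  back : OptionsCovered G (G ⊕ zeroG)
  back s g∈ = _ , ⊕-optˡ s {G} g∈ , ≈g-sym (IH s g∈)

⊕-identityʳ : ∀ G → (G ⊕ zeroG) ≈g G
⊕-identityʳ G = ⊕-identityʳ-fuel _ G ℕₚ.≤-refl

⊕-identityˡ : ∀ G → (zeroG ⊕ G) ≈g G
⊕-identityˡ G = ≈g-trans (⊕-comm zeroG G) (⊕-identityʳ G)

-- Chains {0 | {0 | ⋯ {0 | bottom}}}

-- With bottom false the chain is 1/2ⁿ, with bottom true it is the canonical form of * + (↑*)·n.
bottom : Bool → List Game
bottom false = []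
bottom true  = zeroG ∷ []

mutual
  chain : Bool → ℕ → Game
  chain b n = ⟨ zeroG ∷ [] ∣ chainRights b n ⟩

  chainRights : Bool → ℕ → List Game
  chainRights b zero    = bottom b
  chainRights b (suc n) = chain b n ∷ []

dyadic≡chain : ∀ n → dyadic n ≡ chain false n
dyadic≡chain zero    = refl
dyadic≡chain (suc n) = cong (λ g → ⟨ zeroG ∷ [] ∣ g ∷ [] ⟩) (dyadic≡chain n)

bSeq : ℕ → Game
bSeq = chain true

canonicalUpStar : Game
canonicalUpStar = ⟨ zeroG ∷ star ∷ [] ∣ zeroG ∷ [] ⟩

0≤bSeq-suc : ∀ n → zeroG ≤g bSeq (suc n)
0≤bSeq-suc n = ≤g-intro {zeroG} {bSeq (suc n)} (λ ())
  (λ { (here refl) → ≰g-byLeftOpt (bSeq n) zeroG (here refl) (≤g-refl zeroG) })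

mutual
  bSeq-≤-+2 : ∀ j e → bSeq j ≤g bSeq (suc (suc (e + j)))
  bSeq-≤-+2 j e = ≤g-intro {bSeq j} {bSeq (suc (suc (e + j)))}
    (λ { (here refl) → ≰g-byLeftOpt (bSeq (suc (suc (e + j)))) zeroG (here refl) (≤g-refl zeroG) })
    (λ { (here refl) → bSeq-+1-≰ j e })

  bSeq-+1-≰ : ∀ j e → ¬ (bSeq (suc (e + j)) ≤g bSeq j)
  bSeq-+1-≰ zero    e = ≰g-byRightOpt (bSeq (suc (e + zero))) (bSeq zero) (here refl) (0≤bSeq-suc (e + zero))
  bSeq-+1-≰ (suc j) e = ≰g-byRightOpt (bSeq (suc (e + suc j))) (bSeq (suc j)) (here refl)
    (subst (λ i → bSeq j ≤g bSeq (suc i)) (sym (ℕₚ.+-suc e j)) (bSeq-≤-+2 j e))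

mutual
  star⊕bSeq≤bSeq-+2 : ∀ k → (star ⊕ bSeq k) ≤g bSeq (suc (suc k))
  star⊕bSeq≤bSeq-+2 k =
    ≤g-intro {star ⊕ bSeq k} {bSeq (suc (suc k))} noLeft (λ { (here refl) → bSeq-suc≰star⊕bSeq k })
    where
    noLeft : ∀ {x} → x ∈ lefts (star ⊕ bSeq k) → ¬ (bSeq (suc (suc k)) ≤g x)
    noLeft x∈ with ⊕-opt⁻ left {star} {bSeq k} x∈
    ... | inj₁ (_ , here refl , refl) = ≰g-respʳ-≈g (bSeq-+1-≰ k 1) (⊕-identityˡ (bSeq k))
    ... | inj₂ (_ , here refl , refl) =
      ≰g-respʳ-≈g {bSeq (suc (suc k))}
        (≰g-byRightOpt (bSeq (suc (suc k))) star (here refl) (0≤bSeq-suc (suc k))) (⊕-identityʳ star)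

  bSeq-suc≰star⊕bSeq : ∀ k → ¬ (bSeq (suc k) ≤g (star ⊕ bSeq k))
  bSeq-suc≰star⊕bSeq zero    = toWitnessFalse {a? = bSeq 1 ≤g? (star ⊕ bSeq 0)} tt
  bSeq-suc≰star⊕bSeq (suc k) =
    ≰g-byRightOpt (bSeq (suc (suc k))) (star ⊕ bSeq (suc k))
      (⊕-optʳ right {star} {bSeq (suc k)} (here refl)) (star⊕bSeq≤bSeq-+2 k)

canonicalUpStar⊕bSeq≈bSeq-suc : ∀ n → (canonicalUpStar ⊕ bSeq n) ≈g bSeq (suc n)
canonicalUpStar⊕bSeq≈bSeq-suc zero =
  toWitness {a? = (canonicalUpStar ⊕ bSeq 0) ≤g? bSeq 1} tt ,
  toWitness {a? = bSeq 1 ≤g? (canonicalUpStar ⊕ bSeq 0)} tt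
canonicalUpStar⊕bSeq≈bSeq-suc (suc n) =
  ≤g-intro {canonicalUpStar ⊕ bSeq N} {bSeq (suc N)} noLeft noRight ,
  ≤g-intro {bSeq (suc N)} {canonicalUpStar ⊕ bSeq N} noLeft′ noRight′
  where
  N = suc n
  noLeft : ∀ {x} → x ∈ lefts (canonicalUpStar ⊕ bSeq N) → ¬ (bSeq (suc N) ≤g x)
  noLeft x∈ with ⊕-opt⁻ left {canonicalUpStar} {bSeq N} x∈
  ... | inj₁ (_ , here refl , refl) = ≰g-respʳ-≈g (bSeq-+1-≰ N 0) (⊕-identityˡ (bSeq N))
  ... | inj₁ (_ , there (here refl) , refl) =
    ≰g-byRightOpt (bSeq (suc N)) (star ⊕ bSeq N) (⊕-optʳ right {star} {bSeq N} (here refl))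
      (star⊕bSeq≤bSeq-+2 n)
  ... | inj₂ (_ , here refl , refl) =
    ≰g-respʳ-≈g {bSeq (suc N)} (≰g-byRightOpt (bSeq (suc N)) canonicalUpStar (here refl) (0≤bSeq-suc N))
      (⊕-identityʳ canonicalUpStar)
  noRight : ∀ {y} → y ∈ rights (bSeq (suc N)) → ¬ (y ≤g (canonicalUpStar ⊕ bSeq N))
  noRight (here refl) =
    ≰g-byRightOpt (bSeq N) (canonicalUpStar ⊕ bSeq N) (⊕-optˡ right {canonicalUpStar} {bSeq N} (here refl))
      (proj₁ (⊕-identityˡ (bSeq N)))
  noLeft′ : ∀ {x} → x ∈ lefts (bSeq (suc N)) → ¬ ((canonicalUpStar ⊕ bSeq N) ≤g x)
  noLeft′ (here refl) =
    ≰g-byLeftOpt (canonicalUpStar ⊕ bSeq N) zeroG (⊕-optˡ left {canonicalUpStar} {bSeq N} (here refl))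
       (≤g-trans {H = bSeq N} {zeroG ⊕ bSeq N} (0≤bSeq-suc n) (proj₂ (⊕-identityˡ (bSeq N))))
  noRight′ : ∀ {y} → y ∈ rights (canonicalUpStar ⊕ bSeq N) → ¬ (y ≤g bSeq (suc N))
  noRight′ y∈ with ⊕-opt⁻ right {canonicalUpStar} {bSeq N} y∈
  ... | inj₁ (_ , here refl , refl) =
    ≰g-byRightOpt (zeroG ⊕ bSeq N) (bSeq (suc N)) (here refl) (proj₂ (⊕-identityˡ (bSeq N)))
  ... | inj₂ (_ , here refl , refl) =
    ≰g-byRightOpt (canonicalUpStar ⊕ bSeq n) (bSeq (suc N)) (here refl) (proj₂ (canonicalUpStar⊕bSeq≈bSeq-suc n))

bSeq≈star⊕upStarTimes : ∀ n → bSeq n ≈g (star ⊕ upStarTimes n)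
bSeq≈star⊕upStarTimes zero    = ≈g-sym (⊕-identityʳ star)
bSeq≈star⊕upStarTimes (suc n) = begin
  bSeq (suc n)              ≈⟨ canonicalUpStar⊕bSeq≈bSeq-suc n ⟨
  canonicalUpStar ⊕ bSeq n  ≈⟨ ⊕-congˡ (bSeq n) canonicalUpStar≈upStar ⟩
  upStar ⊕ bSeq n           ≈⟨ ⊕-congʳ upStar (bSeq≈star⊕upStarTimes n) ⟩
  upStar ⊕ (star ⊕ S)       ≈⟨ ⊕-assoc upStar star S ⟨
  (upStar ⊕ star) ⊕ S       ≈⟨ ⊕-congˡ S (⊕-comm upStar star) ⟩
  (star ⊕ upStar) ⊕ S       ≈⟨ ⊕-assoc star upStar S ⟩
  star ⊕ (upStar ⊕ S)       ∎
  where
  open ≈g-Reasoning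
  S = upStarTimes n
  canonicalUpStar≈upStar : canonicalUpStar ≈g upStar
  canonicalUpStar≈upStar =
    toWitness {a? = canonicalUpStar ≤g? upStar} tt , toWitness {a? = upStar ≤g? canonicalUpStar} tt

-- Canonical forms

NoDominated : List Game → Set
NoDominated L = ∀ (i j : Fin (length L)) → i ≢ j → ¬ (lookup L i ≤g lookup L j)

noDominated⇒≡ : ∀ {L g g′} → NoDominated L → g ∈ L → g′ ∈ L → g ≤g g′ → g ≡ g′
noDominated⇒≡ {L} noDom g∈ g′∈ g≤g′ with index g∈ Finₚ.≟ index g′∈
... | yes i≡j = trans (lookup-index g∈) (trans (cong (lookup L) i≡j) (sym (lookup-index g′∈)))
... | no  i≢j = ⊥-elim (noDom (index g∈) (index g′∈) i≢j
                          (subst₂ _≤g_ (lookup-index g∈) (lookup-index g′∈) g≤g′))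

≡singleton : ∀ {L a} → NoDominated L → (∃ λ x → x ∈ L) → (∀ {x} → x ∈ L → x ≡ a) → L ≡ a ∷ []
≡singleton {[]}        _     (_ , ()) _
≡singleton {x ∷ []}    _     _        all≡a = cong (_∷ []) (all≡a (here refl))
≡singleton {x ∷ y ∷ L} noDom _        all≡a = ⊥-elim (noDom fzero (fsuc fzero) (λ ())
  (subst (x ≤g_) (trans (all≡a (here refl)) (sym (all≡a (there (here refl))))) (≤g-refl x)))

-- In canonical forms an option that is not matched would be dominated or reversible.
canonical-leftOpts-match : ∀ {G H} → Canonical G → Canonical H → G ≈g H →
  ∀ {g} → g ∈ lefts G → ∃ λ h → h ∈ lefts H × g ≈g h
canonical-leftOpts-match {G@(⟨ GL ∣ GR ⟩)} {H@(⟨ HL ∣ HR ⟩)}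
  (canon _ _ noDomG _ revG _) (canon _ _ _ _ revH _) (G≤H , H≤G) {g} g∈
  with ≰g⇒∃ H g (≤g-leftOpt {G} {H} G≤H g∈)
... | inj₂ (x , x∈ , x≤H) = ⊥-elim (revG g g∈ x x∈ (≤g-trans {x} {H} {G} x≤H H≤G))
... | inj₁ (h , h∈ , g≤h) with ≰g⇒∃ G h (≤g-leftOpt {H} {G} H≤G h∈)
...   | inj₂ (x , x∈ , x≤G) = ⊥-elim (revH h h∈ x x∈ (≤g-trans {x} {G} {H} x≤G G≤H))
...   | inj₁ (g′ , g′∈ , h≤g′) with noDominated⇒≡ noDomG g∈ g′∈ (≤g-trans {g} {h} {g′} g≤h h≤g′)
...     | refl = h , h∈ , g≤h , h≤g′

canonical-rightOpts-match : ∀ {G H} → Canonical G → Canonical H → G ≈g H →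
  ∀ {g} → g ∈ rights G → ∃ λ h → h ∈ rights H × g ≈g h
canonical-rightOpts-match {G@(⟨ GL ∣ GR ⟩)} {H@(⟨ HL ∣ HR ⟩)}
  (canon _ _ _ noDomG _ revG) (canon _ _ _ _ _ revH) (G≤H , H≤G) {g} g∈
  with ≰g⇒∃ g H (≤g-rightOpt {H} {G} H≤G g∈)
... | inj₁ (y , y∈ , H≤y) = ⊥-elim (revG g g∈ y y∈ (≤g-trans {G} {H} {y} G≤H H≤y))
... | inj₂ (h , h∈ , h≤g) with ≰g⇒∃ h G (≤g-rightOpt {G} {H} G≤H h∈)
...   | inj₁ (y , y∈ , G≤y) = ⊥-elim (revH h h∈ y y∈ (≤g-trans {H} {G} {y} H≤G G≤y))
...   | inj₂ (g′ , g′∈ , g′≤h) with noDominated⇒≡ noDomG g′∈ g∈ (≤g-trans {g′} {h} {g} g′≤h h≤g)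
...     | refl = h , h∈ , g′≤h , h≤g

UniqueCanonical : Game → Set
UniqueCanonical a = ∀ {x} → Canonical x → x ≈g a → x ≡ a

zeroG-canonical : Canonical zeroG
zeroG-canonical = canon (λ _ ()) (λ _ ()) (λ ()) (λ ()) (λ _ ()) (λ _ ())

zeroG-uniqueCanonical : UniqueCanonical zeroG
zeroG-uniqueCanonical {⟨ [] ∣ [] ⟩} _ _ = refl
zeroG-uniqueCanonical {⟨ _ ∷ _ ∣ _ ⟩} cx x≈0 with canonical-leftOpts-match cx zeroG-canonical x≈0 (here refl)
... | _ , () , _
zeroG-uniqueCanonical {⟨ [] ∣ _ ∷ _ ⟩} cx x≈0 with canonical-rightOpts-match cx zeroG-canonical x≈0 (here refl)
... | _ , () , _

uniqueCanonical-singleOpts : ∀ {a b} → Canonical ⟨ a ∷ [] ∣ b ∷ [] ⟩ →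
  UniqueCanonical a → UniqueCanonical b → UniqueCanonical ⟨ a ∷ [] ∣ b ∷ [] ⟩
uniqueCanonical-singleOpts {a} {b} cG uniqA uniqB {⟨ L ∣ R ⟩} cx@(canon canL canR noDomL noDomR _ _) x≈G =
  cong₂ ⟨_∣_⟩ (≡singleton noDomL someLeft leftIsA) (≡singleton noDomR someRight rightIsB)
  where
  someLeft : ∃ λ g → g ∈ L
  someLeft = let (g , g∈ , _) = canonical-leftOpts-match cG cx (≈g-sym x≈G) (here refl) in g , g∈
  someRight : ∃ λ g → g ∈ R
  someRight = let (g , g∈ , _) = canonical-rightOpts-match cG cx (≈g-sym x≈G) (here refl) in g , g∈
  leftIsA : ∀ {g} → g ∈ L → g ≡ a
  leftIsA g∈ with canonical-leftOpts-match cx cG x≈G g∈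
  ... | _ , here refl , g≈a = uniqA (canL _ g∈) g≈a
  rightIsB : ∀ {g} → g ∈ R → g ≡ b
  rightIsB g∈ with canonical-rightOpts-match cx cG x≈G g∈
  ... | _ , here refl , g≈b = uniqB (canR _ g∈) g≈b

bSeq-canonical : ∀ n → Canonical (bSeq n)
bSeq-canonical n = canon
  (λ { _ (here refl) → zeroG-canonical })
  (rightsCanonical n)
  (λ { fzero fzero 0≢0 _ → 0≢0 refl })
  (noDominatedRights n)
  (λ { _ (here refl) _ () })
  (notReversible n)
  where
  rightsCanonical : ∀ n → ∀ x → x ∈ chainRights true n → Canonical x
  rightsCanonical zero    _ (here refl) = zeroG-canonical
  rightsCanonical (suc n) _ (here refl) = bSeq-canonical n
  noDominatedRights : ∀ n → NoDominated (chainRights true n)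
  noDominatedRights zero    fzero fzero 0≢0 _ = 0≢0 refl
  noDominatedRights (suc n) fzero fzero 0≢0 _ = 0≢0 refl
  notReversible : ∀ n → ∀ x → x ∈ chainRights true n → ∀ y → y ∈ lefts x → ¬ (bSeq n ≤g y)
  notReversible zero    _ (here refl) _ ()
  notReversible (suc n) _ (here refl) _ (here refl) = ≰leftOpt {bSeq (suc n)} (here refl)

bSeq-uniqueCanonical : ∀ n → UniqueCanonical (bSeq n)
bSeq-uniqueCanonical zero    =
  uniqueCanonical-singleOpts (bSeq-canonical zero) zeroG-uniqueCanonical zeroG-uniqueCanonical
bSeq-uniqueCanonical (suc n) =
  uniqueCanonical-singleOpts (bSeq-canonical (suc n)) zeroG-uniqueCanonical (bSeq-uniqueCanonical n)

-- Powers of one half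

half^-suc-double : ∀ d → half^ (suc d) +ℚ half^ (suc d) ≡ half^ d
half^-suc-double d = begin
  ½ *ℚ half^ d +ℚ ½ *ℚ half^ d  ≡⟨ ℚₚ.*-distribʳ-+ (half^ d) ½ ½ ⟨
  (½ +ℚ ½) *ℚ half^ d           ≡⟨ ℚₚ.*-identityˡ (half^ d) ⟩
  half^ d                       ∎
  where open ≡-Reasoning

half^-nonNeg : ∀ d → 0ℚ ≤ℚ half^ d
half^-nonNeg zero    = ℚₚ.<⇒≤ (ℚₚ.positive⁻¹ 1ℚ)
half^-nonNeg (suc d) = subst (_≤ℚ ½ *ℚ half^ d) (ℚₚ.*-zeroʳ ½) (ℚₚ.*-monoˡ-≤-nonNeg ½ (half^-nonNeg d))

≤+nonNeg : ∀ p {q} → 0ℚ ≤ℚ q → p ≤ℚ p +ℚ q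
≤+nonNeg p 0≤q = subst (_≤ℚ p +ℚ _) (ℚₚ.+-identityʳ p) (ℚₚ.+-monoʳ-≤ p 0≤q)

0≤+ : ∀ {p q} → 0ℚ ≤ℚ p → 0ℚ ≤ℚ q → 0ℚ ≤ℚ p +ℚ q
0≤+ {p} {q} 0≤p 0≤q = subst (_≤ℚ p +ℚ q) (ℚₚ.+-identityʳ 0ℚ) (ℚₚ.+-mono-≤ 0≤p 0≤q)

half^-suc-≤ : ∀ d → half^ (suc d) ≤ℚ half^ d
half^-suc-≤ d = subst (half^ (suc d) ≤ℚ_) (half^-suc-double d) (≤+nonNeg (half^ (suc d)) (half^-nonNeg (suc d)))

half^-antimono : ∀ {a b} → a ≤ b → half^ b ≤ℚ half^ a
half^-antimono {zero}  {zero}  _         = ℚₚ.≤-refl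
half^-antimono {zero}  {suc b} _         = ℚₚ.≤-trans (half^-suc-≤ b) (half^-antimono {zero} {b} z≤n)
half^-antimono {suc a} {suc b} (s≤s a≤b) = ℚₚ.*-monoˡ-≤-nonNeg ½ (half^-antimono a≤b)

half^ᵘ : ℕ → ℚᵘ.ℚᵘ
half^ᵘ zero    = ℚᵘ.1ℚᵘ
half^ᵘ (suc n) = ℚᵘ.½ ℚᵘ.* half^ᵘ n

half^ᵘ-unitFraction : ∀ n → ∃ λ d → half^ᵘ n ≡ ℚᵘ.mkℚᵘ (ℤ.+ 1) d × suc d ≡ 2 ^ n
half^ᵘ-unitFraction zero = 0 , refl , refl
half^ᵘ-unitFraction (suc n) with half^ᵘ n | half^ᵘ-unitFraction n
... | _ | d , refl , 1+d≡2^n = _ , refl , cong (2 *_) 1+d≡2^n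

toℚᵘ-half^ : ∀ n → toℚᵘ (half^ n) ℚᵘ.≃ half^ᵘ n
toℚᵘ-half^ zero    = ℚᵘₚ.≃-refl
toℚᵘ-half^ (suc n) =
  ℚᵘₚ.≃-trans (ℚₚ.toℚᵘ-homo-* ½ (half^ n)) (ℚᵘₚ.*-congˡ {ℚᵘ.½} (toℚᵘ-half^ n))

n<2^n : ∀ n → n < 2 ^ n
n<2^n zero    = s≤s z≤n
n<2^n (suc n) = subst₂ _≤_ (ℕₚ.+-comm (suc n) 1) (cong (λ x → 2 ^ n + x) (sym (ℕₚ.+-identityʳ (2 ^ n))))
                       (ℕₚ.+-mono-≤ (n<2^n n) (ℕₚ.m^n>0 2 n))

-- For ε = (1+p)/d one has (1/2)^d = 1/2^d < 1/d ≤ ε.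
half^<ε : ∀ ε → 0ℚ <ℚ ε → ∃ λ N → half^ N <ℚ ε
half^<ε (mkℚ (ℤ.+ zero) _ _) (ℚ.*<* (ℤ.+<+ ()))
half^<ε ε@(mkℚ +[1+ p ] d-1 _) _ =
  d , ℚₚ.toℚᵘ-cancel-< (ℚᵘₚ.<-respˡ-≃ (ℚᵘₚ.≃-sym (toℚᵘ-half^ d)) half^ᵘ<ε)
  where
  d = suc d-1
  half^ᵘ<ε : half^ᵘ d ℚᵘ.< toℚᵘ ε
  half^ᵘ<ε with half^ᵘ d | half^ᵘ-unitFraction d
  ... | _ | e , refl , 1+e≡2^d =
    ℚᵘ.*<* (subst₂ ℤ._<_ (sym (ℤₚ.*-identityˡ (ℤ.+ d))) (ℤₚ.pos-* (suc p) (suc e)) (ℤ.+<+ d<[1+p]2^d))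
    where
    d<[1+p]2^d : d < suc p * suc e
    d<[1+p]2^d = ℕₚ.<-≤-trans (n<2^n d) (subst (_≤ suc p * suc e) 1+e≡2^d (ℕₚ.m≤n*m (suc e) (suc p)))

fourHalf^ : ℕ → ℚ
fourHalf^ d = half^ d +ℚ (half^ d +ℚ (half^ d +ℚ half^ d))

fourHalf^-suc : ∀ d → fourHalf^ (suc d) ≡ half^ d +ℚ half^ d
fourHalf^-suc d = trans (sym (ℚₚ.+-assoc x x (x +ℚ x))) (cong₂ _+ℚ_ (half^-suc-double d) (half^-suc-double d))
  where x = half^ (suc d)

fourHalf^-+2 : ∀ d → fourHalf^ (suc (suc d)) ≡ half^ d
fourHalf^-+2 d = trans (fourHalf^-suc (suc d)) (half^-suc-double d)

fourHalf^-antimono : ∀ {a b} → a ≤ b → fourHalf^ b ≤ℚ fourHalf^ a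
fourHalf^-antimono a≤b = ℚₚ.+-mono-≤ h≤ (ℚₚ.+-mono-≤ h≤ (ℚₚ.+-mono-≤ h≤ h≤))
  where h≤ = half^-antimono a≤b

fourHalf^-nonNeg : ∀ d → 0ℚ ≤ℚ fourHalf^ d
fourHalf^-nonNeg d = 0≤+ h (0≤+ h (0≤+ h h))
  where h = half^-nonNeg d

half^+half^+fourHalf^-suc : ∀ d → half^ d +ℚ (half^ d +ℚ fourHalf^ (suc d)) ≡ fourHalf^ d
half^+half^+fourHalf^-suc d = cong (λ x → half^ d +ℚ (half^ d +ℚ x)) (fourHalf^-suc d)

-- Two removed edges at each of the depths a + r, …, a + 1, followed by one at depth a.
removalCost : ℕ → ℕ → ℚ
removalCost a zero    = half^ a
removalCost a (suc r) = half^ (suc r + a) +ℚ (half^ (suc r + a) +ℚ removalCost a r)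

removalCost+double : ∀ a r →
  removalCost a r +ℚ (half^ (r + a) +ℚ half^ (r + a)) ≡ half^ a +ℚ (half^ a +ℚ half^ a)
removalCost+double a zero    = refl
removalCost+double a (suc r) = begin
  (x +ℚ (x +ℚ R)) +ℚ (x +ℚ x)
    ≡⟨ solve 2 (λ x R → (x :+ (x :+ R)) :+ (x :+ x) := R :+ (x :+ (x :+ (x :+ x)))) refl x R ⟩
  R +ℚ fourHalf^ (suc r + a)
    ≡⟨ cong (R +ℚ_) (fourHalf^-suc (r + a)) ⟩
  R +ℚ (half^ (r + a) +ℚ half^ (r + a))
    ≡⟨ removalCost+double a r ⟩
  half^ a +ℚ (half^ a +ℚ half^ a)
    ∎
  where
  open ≡-Reasoning
  x = half^ (suc r + a)
  R = removalCost a r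

half^+removalCost≤fourHalf^ : ∀ a r → half^ a +ℚ removalCost a r ≤ℚ fourHalf^ a
half^+removalCost≤fourHalf^ a r = ℚₚ.+-monoʳ-≤ h (subst (removalCost a r ≤ℚ_) (removalCost+double a r)
  (≤+nonNeg (removalCost a r) (0≤+ (half^-nonNeg (r + a)) (half^-nonNeg (r + a)))))
  where h = half^ a

-- Edit sequences and their costs

_⊆E_ : EdgeSet → EdgeSet → Set
E ⊆E F = ∀ {col x y} → E col x y → F col x y

_⇔E_ : EdgeSet → EdgeSet → Set
E ⇔E F = (E ⊆E F) × (F ⊆E E)

-- U is meant to contain every graph met along an edit sequence, so that one potential
-- certifies distances in all of them.
Potential : EdgeSet → (Game → ℕ) → Set
Potential U φ = ∀ {col x y} → U col x y → φ y ≤ suc (φ x)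

potential≤length : ∀ {E U φ s v l} → E ⊆E U → Potential U φ → φ s ≡ 0 → Path E s v l → φ v ≤ l
potential≤length E⊆U pot φs≡0 here          = ℕₚ.≤-reflexive φs≡0
potential≤length E⊆U pot φs≡0 (step p edge) =
  ℕₚ.≤-trans (pot (E⊆U edge)) (s≤s (potential≤length E⊆U pot φs≡0 p))

dist-byPotential : ∀ {E U φ s v d} → E ⊆E U → Potential U φ → φ s ≡ 0 →
                   Path E s v d → φ v ≡ d → Dist E s v d
dist-byPotential E⊆U pot φs≡0 p φv≡d = p , λ l q → subst (_≤ l) φv≡d (potential≤length E⊆U pot φs≡0 q)

EditsInto : Game → EdgeSet → (EdgeSet → Set) → ℚ → Set₁
EditsInto s E P B = ∃ λ F → ∃ λ q → Edits s E F q × P F × q ≤ℚ B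

module _ {s : Game} {P : EdgeSet → Set} where

  editsInto-done : ∀ {E} → P E → EditsInto s E P 0ℚ
  editsInto-done PE = _ , 0ℚ , done , PE , ℚₚ.≤-refl

  editsInto-add : ∀ {E B col u v} {d} → ¬ E col u v → Dist E s u d →
                  EditsInto s (addE E col u v) P B → EditsInto s E P (half^ d +ℚ B)
  editsInto-add {d = d} new dist (F , q , edits , PF , q≤B) =
    F , _ , add new dist edits , PF , ℚₚ.+-monoʳ-≤ (half^ d) q≤B

  editsInto-rem : ∀ {E B col u v} {d} → E col u v → Dist E s u d →
                  EditsInto s (remE E col u v) P B → EditsInto s E P (half^ d +ℚ B)
  editsInto-rem {d = d} old dist (F , q , edits , PF , q≤B) =
    F , _ , rem old dist edits , PF , ℚₚ.+-monoʳ-≤ (half^ d) q≤B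

  editsInto-weaken : ∀ {E B B′} → B ≤ℚ B′ → EditsInto s E P B → EditsInto s E P B′
  editsInto-weaken B≤B′ (F , q , edits , PF , q≤B) = F , q , edits , PF , ℚₚ.≤-trans q≤B B≤B′

editsInto-map : ∀ {s E B} {P Q : EdgeSet → Set} → (∀ {F} → P F → Q F) → EditsInto s E P B → EditsInto s E Q B
editsInto-map P⇒Q (F , q , edits , PF , q≤B) = F , q , edits , P⇒Q PF , q≤B

iso-fromRetraction : ∀ {F D T : EdgeSet} {s t} (f g : Game → Game) (V : Game → Set) →
  F ⇔E D → DE t ⇔E T → f s ≡ t → V s →
  (∀ {col x y} → D col x y → V x × V y) →
  (∀ {x} → V x → g (f x) ≡ x) →
  (∀ {col x y} → D col x y → T col (f x) (f y)) →
  (∀ {col x′ y′} → T col x′ y′ → ∃ λ x → ∃ λ y → D col x y × f x ≡ x′ × f y ≡ y′) →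
  Iso F s (DE t) t
iso-fromRetraction {F} {s = s} f g V (F⊆D , D⊆F) (DE⊆T , T⊆DE) fs≡t Vs ends retract pres onto =
  f , fs≡t , injective , (λ col x y edge → T⊆DE (pres (F⊆D edge))) , surjective
  where
  vertex : ∀ {x} → Vert F s x → V x
  vertex (inj₁ refl)                = Vs
  vertex (inj₂ (_ , _ , inj₁ edge)) = proj₁ (ends (F⊆D edge))
  vertex (inj₂ (_ , _ , inj₂ edge)) = proj₂ (ends (F⊆D edge))
  injective : ∀ x y → Vert F s x → Vert F s y → f x ≡ f y → x ≡ y
  injective x y vx vy fx≡fy = trans (sym (retract (vertex vx))) (trans (cong g fx≡fy) (retract (vertex vy)))
  surjective : ∀ col x′ y′ → DE _ col x′ y′ → ∃ λ x → ∃ λ y → F col x y × f x ≡ x′ × f y ≡ y′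
  surjective col x′ y′ edge with onto (DE⊆T edge)
  ... | x , y , d , fx≡x′ , fy≡y′ = x , y , D⊆F d , fx≡x′ , fy≡y′

-- The DAG of a chain

rank : Game → ℕ
rank ⟨ _ ∣ [] ⟩                  = 0
rank ⟨ _ ∣ ⟨ [] ∣ _ ⟩ ∷ _ ⟩      = 0
rank ⟨ _ ∣ ⟨ x ∷ xs ∣ R ⟩ ∷ _ ⟩  = suc (rank ⟨ x ∷ xs ∣ R ⟩)

rank-chain : ∀ b j → rank (chain b j) ≡ j
rank-chain false zero    = refl
rank-chain true  zero    = refl
rank-chain b     (suc j) = cong suc (rank-chain b j)

∈bottom⇒≡0 : ∀ {b v} → v ∈ bottom b → v ≡ zeroG
∈bottom⇒≡0 {true} (here refl) = refl

∸-≤-suc : ∀ m n → m ∸ n ≤ suc (m ∸ suc n)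
∸-≤-suc zero    n       = subst (_≤ 1) (sym (ℕₚ.0∸n≡0 n)) z≤n
∸-≤-suc (suc m) zero    = ℕₚ.≤-refl
∸-≤-suc (suc m) (suc n) = ∸-≤-suc m n

<⇒≡suc+ : ∀ {k j} → k < j → ∃ λ i → j ≡ suc i + k
<⇒≡suc+ {k} {j} k<j = j ∸ suc k , trans (sym (ℕₚ.m∸n+n≡m k<j)) (ℕₚ.+-suc (j ∸ suc k) k)

module ChainGraph (b : Bool) where

  c : ℕ → Game
  c = chain b

  c-injective : ∀ {i j} → c i ≡ c j → i ≡ j
  c-injective {i} {j} ci≡cj = trans (sym (rank-chain b i)) (trans (cong rank ci≡cj) (rank-chain b j))

  data ChainEdge (n : ℕ) : Color → Game → Game → Set where
    blueEdge   : ∀ {j} → j ≤ n → ChainEdge n blue (c j) zeroG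
    redEdge    : ∀ {j} → suc j ≤ n → ChainEdge n red (c (suc j)) (c j)
    bottomEdge : ∀ {v} → v ∈ bottom b → ChainEdge n red (c 0) v

  sub-chain : ∀ {n x} → Sub (c n) x → (∃ λ j → j ≤ n × x ≡ c j) ⊎ x ≡ zeroG
  sub-chain {n} self = inj₁ (n , ℕₚ.≤-refl , refl)
  sub-chain {n} (viaL p x∈) with sub-chain {n} p
  sub-chain {n} (viaL p (here refl)) | inj₁ (_ , _ , refl) = inj₂ refl
  sub-chain {n} (viaL p ())          | inj₂ refl
  sub-chain {n} (viaR p x∈) with sub-chain {n} p
  sub-chain {n} (viaR p x∈)          | inj₁ (zero , _ , refl)      = inj₂ (∈bottom⇒≡0 x∈)
  sub-chain {n} (viaR p (here refl)) | inj₁ (suc j , j<n , refl)  = inj₁ (j , ℕₚ.≤-trans (ℕₚ.n≤1+n j) j<n , refl)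
  sub-chain {n} (viaR p ())          | inj₂ refl

  sub-chain⁻ : ∀ {n j} → j ≤ n → Sub (c n) (c j)
  sub-chain⁻ {n} {j} j≤n = down (n ∸ j) (subst (Sub (c n) ∘ c) (sym (ℕₚ.m∸n+n≡m j≤n)) self)
    where
    down : ∀ d → Sub (c n) (c (d + j)) → Sub (c n) (c j)
    down zero    p = p
    down (suc d) p = down d (viaR p (here refl))

  DE⊆ChainEdge : ∀ {n} → DE (c n) ⊆E ChainEdge n
  DE⊆ChainEdge {n} {blue} (p , v∈) with sub-chain {n} p
  DE⊆ChainEdge {n} {blue} (p , here refl) | inj₁ (_ , j≤n , refl) = blueEdge j≤n
  DE⊆ChainEdge {n} {blue} (p , ())        | inj₂ refl
  DE⊆ChainEdge {n} {red}  (p , v∈) with sub-chain {n} p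
  DE⊆ChainEdge {n} {red}  (p , v∈)        | inj₁ (zero , _ , refl)      = bottomEdge v∈
  DE⊆ChainEdge {n} {red}  (p , here refl) | inj₁ (suc j , j<n , refl)  = redEdge j<n
  DE⊆ChainEdge {n} {red}  (p , ())        | inj₂ refl

  ChainEdge⊆DE : ∀ {n} → ChainEdge n ⊆E DE (c n)
  ChainEdge⊆DE {n} (blueEdge j≤n)  = sub-chain⁻ {n} j≤n , here refl
  ChainEdge⊆DE {n} (redEdge j<n)   = sub-chain⁻ {n} j<n , here refl
  ChainEdge⊆DE {n} (bottomEdge v∈) = sub-chain⁻ {n} z≤n , v∈

  DE⇔ChainEdge : ∀ n → DE (c n) ⇔E ChainEdge n
  DE⇔ChainEdge n = DE⊆ChainEdge , ChainEdge⊆DE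

  -- The depth of c (suc j) below c n; for c 0 only the trivial lower bound is needed.
  chainDepth : ℕ → ℕ → ℕ
  chainDepth n zero    = 0
  chainDepth n (suc j) = n ∸ suc j

  chainDepth-step : ∀ n j → chainDepth n j ≤ suc (chainDepth n (suc j))
  chainDepth-step n zero    = z≤n
  chainDepth-step n (suc j) = ∸-≤-suc n (suc j)

  module ChainPotential {n} (φ : Game → ℕ) (φ-c : ∀ j → φ (c j) ≡ chainDepth n j) (φ-0 : φ zeroG ≡ 0) where

    φ-redStep : ∀ j → φ (c j) ≤ suc (φ (c (suc j)))
    φ-redStep j = subst₂ (λ p q → p ≤ suc q) (sym (φ-c j)) (sym (φ-c (suc j))) (chainDepth-step n j)

    φ-zeroStep : ∀ {x v} → v ≡ zeroG → φ v ≤ suc (φ x)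
    φ-zeroStep {x} refl = subst (_≤ suc (φ x)) (sym φ-0) z≤n

    ChainEdge-potential : Potential (ChainEdge n) φ
    ChainEdge-potential (blueEdge _)    = φ-zeroStep refl
    ChainEdge-potential (redEdge {j} _) = φ-redStep j
    ChainEdge-potential (bottomEdge v∈) = φ-zeroStep (∈bottom⇒≡0 v∈)

  path-down : ∀ {E} n i j → i + j ≡ n →
              (∀ {j′} → j ≤ j′ → j′ < n → E red (c (suc (suc j′))) (c (suc j′))) →
              Path E (c (suc n)) (c (suc j)) i
  path-down n zero    j refl redEdges = here
  path-down n (suc i) j i+j≡n redEdges =
    step (path-down n i (suc j) (trans (ℕₚ.+-suc i j) i+j≡n)
                    (λ j<j′ → redEdges (ℕₚ.≤-trans (ℕₚ.n≤1+n _) j<j′)))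
         (redEdges ℕₚ.≤-refl (subst (suc j ≤_) i+j≡n (s≤s (ℕₚ.m≤n+m j i))))

-- Lengthening a chain

-- The edges of the inserted path c 1 → ν k → ⋯ → ν 1 → c 0 are added from the top down,
-- so that the source of each new edge is already reachable.
module Lengthen (b : Bool) (n₀ k₀ : ℕ) where
  open ChainGraph b

  n k m : ℕ
  n = suc n₀
  k = suc k₀
  m = n + k

  s : Game
  s = c n

  -- ν (suc t) has no Left option, so it is neither 0 nor a chain node.
  ν : ℕ → Game
  ν zero    = c 0
  ν (suc t) = ⟨ [] ∣ c (suc t) ∷ [] ⟩

  -- The graph once the edges out of ν k, …, ν (suc t) have been added.
  data Stage (t : ℕ) : Color → Game → Game → Set where
    chainBlue  : ∀ {j} → j ≤ n → Stage t blue (c j) zeroG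
    chainRed   : ∀ {j} → suc (suc j) ≤ n → Stage t red (c (suc (suc j))) (c (suc j))
    detour     : Stage t red (c 1) (ν k)
    bottomRed  : ∀ {v} → v ∈ bottom b → Stage t red (c 0) v
    freshBlue  : ∀ {t′} → t < t′ → t′ ≤ k → Stage t blue (ν t′) zeroG
    freshRed   : ∀ {t′} → t ≤ t′ → t′ < k → Stage t red (ν (suc t′)) (ν t′)

  Stage-weaken : ∀ {t} → Stage (suc t) ⊆E Stage t
  Stage-weaken (chainBlue j≤n)        = chainBlue j≤n
  Stage-weaken (chainRed j<n)         = chainRed j<n
  Stage-weaken detour                 = detour
  Stage-weaken (bottomRed v∈)         = bottomRed v∈
  Stage-weaken (freshBlue t<t′ t′≤k)  = freshBlue (ℕₚ.<-trans (ℕₚ.n<1+n _) t<t′) t′≤k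
  Stage-weaken (freshRed t≤t′ t′<k)   = freshRed (ℕₚ.≤-trans (ℕₚ.n≤1+n _) t≤t′) t′<k

  Stage⊆Stage0 : ∀ t → Stage t ⊆E Stage 0
  Stage⊆Stage0 zero    edge = edge
  Stage⊆Stage0 (suc t) edge = Stage⊆Stage0 t (Stage-weaken edge)

  Stage-init : addE (remE (DE s) red (c 1) (c 0)) red (c 1) (ν k) ⇔E Stage k
  Stage-init = forth , back
    where
    forth : addE (remE (DE s) red (c 1) (c 0)) red (c 1) (ν k) ⊆E Stage k
    forth (inj₁ (edge , notCut)) with DE⊆ChainEdge {n} edge
    ... | blueEdge j≤n       = chainBlue j≤n
    ... | redEdge {zero} _   = ⊥-elim (notCut (refl , refl , refl))
    ... | redEdge {suc j} j<n = chainRed j<n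
    ... | bottomEdge v∈      = bottomRed v∈
    forth (inj₂ (refl , refl , refl)) = detour
    back : Stage k ⊆E addE (remE (DE s) red (c 1) (c 0)) red (c 1) (ν k)
    back (chainBlue j≤n) = inj₁ (ChainEdge⊆DE {n} (blueEdge j≤n) , λ { (() , _) })
    back (chainRed {j} j<n) = inj₁ (ChainEdge⊆DE {n} (redEdge j<n) ,
      λ { (_ , c2+j≡c1 , _) → ℕₚ.1+n≢0 (ℕₚ.suc-injective (c-injective {suc (suc j)} {1} c2+j≡c1)) })
    back detour = inj₂ (refl , refl , refl)
    back (bottomRed v∈) = inj₁ (ChainEdge⊆DE {n} (bottomEdge v∈) ,
      λ { (_ , c0≡c1 , _) → ℕₚ.0≢1+n (c-injective {0} {1} c0≡c1) })
    back (freshBlue k<t′ t′≤k) = ⊥-elim (ℕₚ.<⇒≱ k<t′ t′≤k)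
    back (freshRed k≤t′ t′<k)  = ⊥-elim (ℕₚ.<⇒≱ t′<k k≤t′)

  Stage-step : ∀ {t E} → t < k → E ⇔E Stage (suc t) →
               addE (addE E blue (ν (suc t)) zeroG) red (ν (suc t)) (ν t) ⇔E Stage t
  Stage-step {t} {E} t<k (to , from) = forth , back
    where
    forth : addE (addE E blue (ν (suc t)) zeroG) red (ν (suc t)) (ν t) ⊆E Stage t
    forth (inj₁ (inj₁ edge))               = Stage-weaken (to edge)
    forth (inj₁ (inj₂ (refl , refl , refl))) = freshBlue ℕₚ.≤-refl t<k
    forth (inj₂ (refl , refl , refl))        = freshRed ℕₚ.≤-refl t<k
    back : Stage t ⊆E addE (addE E blue (ν (suc t)) zeroG) red (ν (suc t)) (ν t)
    back (chainBlue j≤n) = inj₁ (inj₁ (from (chainBlue j≤n)))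
    back (chainRed j<n)  = inj₁ (inj₁ (from (chainRed j<n)))
    back detour          = inj₁ (inj₁ (from detour))
    back (bottomRed v∈)  = inj₁ (inj₁ (from (bottomRed v∈)))
    back (freshBlue t<t′ t′≤k) with ℕₚ.m≤n⇒m<n∨m≡n t<t′
    ... | inj₁ 1+t<t′ = inj₁ (inj₁ (from (freshBlue 1+t<t′ t′≤k)))
    ... | inj₂ refl   = inj₁ (inj₂ (refl , refl , refl))
    back (freshRed t≤t′ t′<k) with ℕₚ.m≤n⇒m<n∨m≡n t≤t′
    ... | inj₁ t<t′ = inj₁ (inj₁ (from (freshRed t<t′ t′<k)))
    ... | inj₂ refl = inj₂ (refl , refl , refl)

  firstRight : Game → Game
  firstRight ⟨ _ ∣ y ∷ _ ⟩ = y
  firstRight _             = zeroG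

  ν-injective : ∀ {t t′} → ν t ≡ ν t′ → t ≡ t′
  ν-injective {zero}  {zero}   _ = refl
  ν-injective {zero}  {suc _}  ()
  ν-injective {suc _} {zero}   ()
  ν-injective {suc t} {suc t′} ν≡ = c-injective (cong firstRight ν≡)

  Stage-noFreshBlue : ∀ {t col x y} → Stage (suc t) col x y → x ≡ ν (suc t) → col ≡ blue → ⊥
  Stage-noFreshBlue (chainBlue _)         () _
  Stage-noFreshBlue (chainRed _)          () _
  Stage-noFreshBlue detour                () _
  Stage-noFreshBlue (bottomRed _)         () _
  Stage-noFreshBlue {t} (freshBlue {t′} t<t′ _) x≡ _ with ν-injective {t′} {suc t} x≡
  ... | refl = ℕₚ.<-irrefl refl t<t′
  Stage-noFreshBlue (freshRed _ _)        _ ()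

  Stage-noFreshRed : ∀ {t col x y} → Stage (suc t) col x y → x ≡ ν (suc t) → col ≡ red → ⊥
  Stage-noFreshRed (chainBlue _)         _ ()
  Stage-noFreshRed (chainRed _)          () _
  Stage-noFreshRed detour                () _
  Stage-noFreshRed (bottomRed _)         () _
  Stage-noFreshRed (freshBlue _ _)       _ ()
  Stage-noFreshRed {t} (freshRed {t′} t≤t′ _) x≡ _ with ν-injective {suc t′} {suc t} x≡
  ... | refl = ℕₚ.<-irrefl refl t≤t′

  ChainEdge-noFreshTarget : ∀ {col x y t} → ChainEdge n col x y → y ≡ ν (suc t) → ⊥
  ChainEdge-noFreshTarget (blueEdge _)    ()
  ChainEdge-noFreshTarget (redEdge _)     ()
  ChainEdge-noFreshTarget (bottomEdge v∈) y≡ with ∈bottom⇒≡0 v∈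
  ChainEdge-noFreshTarget (bottomEdge v∈) () | refl

  φ : Game → ℕ
  φ ⟨ [] ∣ [] ⟩        = 0
  φ ⟨ [] ∣ y ∷ _ ⟩     = n + (k ∸ rank y)
  φ ⟨ a ∷ as ∣ R ⟩     = chainDepth n (rank ⟨ a ∷ as ∣ R ⟩)

  φ-c : ∀ j → φ (c j) ≡ chainDepth n j
  φ-c j = cong (chainDepth n) (rank-chain b j)

  φ-ν : ∀ t → φ (ν (suc t)) ≡ n + (k ∸ suc t)
  φ-ν t = cong (λ r → n + (k ∸ r)) (rank-chain b (suc t))

  φ-s : φ s ≡ 0
  φ-s = trans (φ-c n) (ℕₚ.n∸n≡0 n₀)

  n+[k∸k]≡n : n + (k ∸ k) ≡ n
  n+[k∸k]≡n = trans (cong (n +_) (ℕₚ.n∸n≡0 k)) (ℕₚ.+-identityʳ n)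

  Everything : EdgeSet
  Everything col x y = ChainEdge n col x y ⊎ Stage 0 col x y

  via : ∀ x y {p q} → φ y ≡ p → φ x ≡ q → p ≤ suc q → φ y ≤ suc (φ x)
  via _ _ refl refl p≤ = p≤

  open ChainPotential φ φ-c refl

  φ-potential : Potential Everything φ
  φ-potential (inj₁ edge)                     = ChainEdge-potential edge
  φ-potential (inj₂ (chainBlue _))            = z≤n
  φ-potential (inj₂ (chainRed {j} _))         = φ-redStep (suc j)
  φ-potential (inj₂ detour)                   = via (c 1) (ν k) (φ-ν k₀) (φ-c 1) (ℕₚ.≤-reflexive n+[k∸k]≡n)
  φ-potential (inj₂ (bottomRed v∈))           = φ-zeroStep {c 0} (∈bottom⇒≡0 v∈)
  φ-potential (inj₂ (freshBlue _ _))          = z≤n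
  φ-potential (inj₂ (freshRed {zero} _ _))    = via (ν 1) (c 0) (φ-c 0) refl z≤n
  φ-potential (inj₂ (freshRed {suc t} _ _))   = via (ν (suc (suc t))) (ν (suc t)) (φ-ν t) (φ-ν (suc t))
    (subst (n + (k ∸ suc t) ≤_) (ℕₚ.+-suc n _) (ℕₚ.+-monoʳ-≤ n (∸-≤-suc k (suc t))))

  path-c1 : ∀ {E} → (∀ {j} → j < n₀ → E red (c (suc (suc j))) (c (suc j))) → Path E s (c 1) n₀
  path-c1 {E} redEdges = path-down {E} n₀ n₀ 0 (ℕₚ.+-identityʳ n₀) (λ _ j<n₀ → redEdges j<n₀)

  dist-c1 : ∀ {E} → E ⊆E Everything → (∀ {j} → j < n₀ → E red (c (suc (suc j))) (c (suc j))) →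
            Dist E s (c 1) n₀
  dist-c1 {E} E⊆ redEdges = dist-byPotential {E} E⊆ φ-potential φ-s (path-c1 {E} redEdges) (φ-c 1)

  path-ν : ∀ {E t} → Stage (suc t) ⊆E E → ∀ i t′ → i + t′ ≡ k → suc t ≤ t′ → Path E s (ν t′) (i + n)
  path-ν {E} from zero t′ refl _ = step (path-c1 {E} (λ j<n₀ → from (chainRed (s≤s j<n₀)))) (from detour)
  path-ν {E} {t} from (suc i) t′ i+t′≡k t<t′ =
    step (path-ν {E} {t} from i (suc t′) (trans (ℕₚ.+-suc i t′) i+t′≡k) (ℕₚ.≤-trans t<t′ (ℕₚ.n≤1+n t′)))
         (from (freshRed t<t′ (subst (suc t′ ≤_) i+t′≡k (s≤s (ℕₚ.m≤n+m t′ i)))))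

  dist-ν : ∀ {E t} → Stage (suc t) ⊆E E → E ⊆E Everything → suc t ≤ k →
           Dist E s (ν (suc t)) (n + (k ∸ suc t))
  dist-ν {E} {t} from E⊆ t<k = dist-byPotential {E} E⊆ φ-potential φ-s
    (subst (Path E s (ν (suc t))) (ℕₚ.+-comm (k ∸ suc t) n)
      (path-ν {E} {t} from (k ∸ suc t) (suc t) (ℕₚ.m∸n+n≡m t<k) ℕₚ.≤-refl))
    (φ-ν t)

  insertFresh : ∀ t → t ≤ k → ∀ {E} → E ⇔E Stage t →
                EditsInto s E (_⇔E Stage 0) (fourHalf^ (n + (k ∸ t)))
  insertFresh zero    _   E⇔ = editsInto-weaken (fourHalf^-nonNeg (n + (k ∸ zero))) (editsInto-done E⇔)
  insertFresh (suc t) t<k {E} E⇔@(to , from) =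
    editsInto-weaken (ℚₚ.≤-reflexive cost≡)
      (editsInto-add (λ edge → Stage-noFreshBlue (to edge) refl refl)
                     (dist-ν {E} {t} from (λ edge → inj₂ (Stage⊆Stage0 (suc t) (to edge))) t<k)
      (editsInto-add (λ { (inj₁ edge) → Stage-noFreshRed (to edge) refl refl ; (inj₂ (() , _)) })
                     (dist-ν {E′} {t} (λ edge → inj₁ (from edge)) E′⊆ t<k)
      (insertFresh t (ℕₚ.≤-trans (ℕₚ.n≤1+n t) t<k) (Stage-step t<k E⇔))))
    where
    d = n + (k ∸ suc t)
    E′ = addE E blue (ν (suc t)) zeroG
    E′⊆ : E′ ⊆E Everything
    E′⊆ (inj₁ edge)               = inj₂ (Stage⊆Stage0 (suc t) (to edge))
    E′⊆ (inj₂ (refl , refl , refl)) = inj₂ (freshBlue (s≤s z≤n) t<k)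
    cost≡ : half^ d +ℚ (half^ d +ℚ fourHalf^ (n + (k ∸ t))) ≡ fourHalf^ d
    cost≡ = trans (cong (λ e → half^ d +ℚ (half^ d +ℚ fourHalf^ e)) n+[k∸t]≡1+d) (half^+half^+fourHalf^-suc d)
      where
      n+[k∸t]≡1+d : n + (k ∸ t) ≡ suc d
      n+[k∸t]≡1+d = trans (cong (n +_) (ℕₚ.+-∸-assoc 1 t<k)) (ℕₚ.+-suc n (k ∸ suc t))

  edits : EditsInto s (DE s) (_⇔E Stage 0) (fourHalf^ n₀)
  edits =
    editsInto-weaken (ℚₚ.≤-reflexive cost≡)
      (editsInto-rem (ChainEdge⊆DE {n} (redEdge (s≤s z≤n)))
                     (dist-c1 {DE s} DE⊆ (λ j<n₀ → ChainEdge⊆DE {n} (redEdge (s≤s j<n₀))))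
      (editsInto-add (λ (edge , _) → ChainEdge-noFreshTarget {red} {c 1} {ν k} {k₀} (DE⊆ChainEdge {n} edge) refl)
                     (dist-c1 {E₁} (λ (edge , _) → DE⊆ edge) redEdges₁)
      (insertFresh k ℕₚ.≤-refl Stage-init)))
    where
    E₁ = remE (DE s) red (c 1) (c 0)
    DE⊆ : DE s ⊆E Everything
    DE⊆ edge = inj₁ (DE⊆ChainEdge {n} edge)
    redEdges₁ : ∀ {j} → j < n₀ → E₁ red (c (suc (suc j))) (c (suc j))
    redEdges₁ {j} j<n₀ = ChainEdge⊆DE {n} (redEdge (s≤s j<n₀)) ,
      λ { (_ , c2+j≡c1 , _) → ℕₚ.1+n≢0 (ℕₚ.suc-injective (c-injective {suc (suc j)} {1} c2+j≡c1)) }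
    cost≡ : half^ n₀ +ℚ (half^ n₀ +ℚ fourHalf^ (n + (k ∸ k))) ≡ fourHalf^ n₀
    cost≡ = trans (cong (λ e → half^ n₀ +ℚ (half^ n₀ +ℚ fourHalf^ e)) n+[k∸k]≡n) (half^+half^+fourHalf^-suc n₀)

  shift : ℕ → ℕ
  shift zero    = 0
  shift (suc j) = suc j + k

  decode : Game → Game
  decode ⟨ [] ∣ [] ⟩    = zeroG
  decode ⟨ [] ∣ y ∷ _ ⟩ = y
  decode ⟨ a ∷ as ∣ R ⟩ = c (shift (rank ⟨ a ∷ as ∣ R ⟩))

  decode-c : ∀ j → decode (c j) ≡ c (shift j)
  decode-c j = cong (c ∘ shift) (rank-chain b j)

  decode-ν : ∀ t → decode (ν t) ≡ c t
  decode-ν zero    = decode-c 0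
  decode-ν (suc t) = refl

  decode-bottom : ∀ {v} → v ∈ bottom b → decode v ≡ v
  decode-bottom v∈ rewrite ∈bottom⇒≡0 v∈ = refl

  unshift : ℕ → Game
  unshift t with t ≤? k
  ... | yes _ = ν t
  ... | no  _ = c (t ∸ k)

  unshift-≤ : ∀ {t} → t ≤ k → unshift t ≡ ν t
  unshift-≤ {t} t≤k with t ≤? k
  ... | yes _   = refl
  ... | no  t≰k = ⊥-elim (t≰k t≤k)

  unshift-> : ∀ {t} → k < t → unshift t ≡ c (t ∸ k)
  unshift-> {t} k<t with t ≤? k
  ... | yes t≤k = ⊥-elim (ℕₚ.<⇒≱ k<t t≤k)
  ... | no  _   = refl

  encode : Game → Game
  encode ⟨ [] ∣ _ ⟩     = zeroG
  encode ⟨ a ∷ as ∣ R ⟩ = unshift (rank ⟨ a ∷ as ∣ R ⟩)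

  encode-c : ∀ t → encode (c t) ≡ unshift t
  encode-c t = cong unshift (rank-chain b t)

  Vertex : Game → Set
  Vertex x = (∃ λ j → j ≤ n × x ≡ c j) ⊎ (∃ λ t → t ≤ k × x ≡ ν t) ⊎ x ≡ zeroG

  encode-decode : ∀ {x} → Vertex x → encode (decode x) ≡ x
  encode-decode (inj₁ (zero , _ , refl)) = trans (cong encode (decode-c 0)) (trans (encode-c 0) (unshift-≤ z≤n))
  encode-decode (inj₁ (suc j , _ , refl)) =
    trans (cong encode (decode-c (suc j))) (trans (encode-c (suc j + k))
      (trans (unshift-> (s≤s (ℕₚ.m≤n+m k j))) (cong c (ℕₚ.m+n∸n≡m (suc j) k))))
  encode-decode (inj₂ (inj₁ (t , t≤k , refl))) = trans (cong encode (decode-ν t)) (trans (encode-c t) (unshift-≤ t≤k))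
  encode-decode (inj₂ (inj₂ refl)) = refl

  Stage0-ends : ∀ {col x y} → Stage 0 col x y → Vertex x × Vertex y
  Stage0-ends (chainBlue j≤n)    = inj₁ (_ , j≤n , refl) , inj₂ (inj₂ refl)
  Stage0-ends (chainRed j<n)     = inj₁ (_ , j<n , refl) , inj₁ (_ , ℕₚ.≤-trans (ℕₚ.n≤1+n _) j<n , refl)
  Stage0-ends detour             = inj₁ (1 , s≤s z≤n , refl) , inj₂ (inj₁ (k , ℕₚ.≤-refl , refl))
  Stage0-ends (bottomRed v∈) rewrite ∈bottom⇒≡0 v∈ = inj₁ (0 , z≤n , refl) , inj₂ (inj₂ refl)
  Stage0-ends (freshBlue _ t≤k)  = inj₂ (inj₁ (_ , t≤k , refl)) , inj₂ (inj₂ refl)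
  Stage0-ends (freshRed _ t<k)   = inj₂ (inj₁ (_ , t<k , refl)) , inj₂ (inj₁ (_ , ℕₚ.<⇒≤ t<k , refl))

  decode-edge : ∀ {col x y} → Stage 0 col x y → ChainEdge m col (decode x) (decode y)
  decode-edge (chainBlue {zero} _) = subst (λ x → ChainEdge m blue x zeroG) (sym (decode-c 0)) (blueEdge z≤n)
  decode-edge (chainBlue {suc j} j≤n) =
    subst (λ x → ChainEdge m blue x zeroG) (sym (decode-c (suc j))) (blueEdge (ℕₚ.+-monoˡ-≤ k j≤n))
  decode-edge (chainRed {j} j<n) =
    subst₂ (ChainEdge m red) (sym (decode-c (suc (suc j)))) (sym (decode-c (suc j))) (redEdge (ℕₚ.+-monoˡ-≤ k j<n))
  decode-edge detour =
    subst (λ x → ChainEdge m red x (c k)) (sym (decode-c 1)) (redEdge (s≤s (ℕₚ.m≤n+m k n₀)))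
  decode-edge (bottomRed v∈) =
    subst₂ (ChainEdge m red) (sym (decode-c 0)) (sym (decode-bottom v∈)) (bottomEdge v∈)
  decode-edge (freshBlue {t′} _ t′≤k) =
    subst (λ x → ChainEdge m blue x zeroG) (sym (decode-ν t′)) (blueEdge (ℕₚ.≤-trans t′≤k (ℕₚ.m≤n+m k n)))
  decode-edge (freshRed {t′} _ t′<k) =
    subst (ChainEdge m red (c (suc t′))) (sym (decode-ν t′)) (redEdge (ℕₚ.≤-trans t′<k (ℕₚ.m≤n+m k n)))

  decode-onto : ∀ {col x′ y′} → ChainEdge m col x′ y′ →
                ∃ λ x → ∃ λ y → Stage 0 col x y × decode x ≡ x′ × decode y ≡ y′
  decode-onto (blueEdge {j} j≤m) with j ≤? k
  decode-onto (blueEdge {zero}  _) | yes _   = c 0 , zeroG , chainBlue z≤n , decode-c 0 , refl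
  decode-onto (blueEdge {suc j} _) | yes j≤k = ν (suc j) , zeroG , freshBlue (s≤s z≤n) j≤k , refl , refl
  ... | no j≰k with <⇒≡suc+ (ℕₚ.≰⇒> j≰k)
  ...   | i , refl = c (suc i) , zeroG , chainBlue (ℕₚ.+-cancelʳ-≤ k (suc i) n j≤m) , decode-c (suc i) , refl
  decode-onto (redEdge {j} j<m) with suc j ≤? k
  ... | yes j<k = ν (suc j) , ν j , freshRed z≤n j<k , refl , decode-ν j
  ... | no j≮k with <⇒≡suc+ (ℕₚ.≰⇒> j≮k)
  ...   | zero , refl  = c 1 , ν k , detour , decode-c 1 , refl
  ...   | suc i , refl =
    c (suc (suc i)) , c (suc i) , chainRed (ℕₚ.+-cancelʳ-≤ k (suc (suc i)) n j<m) , decode-c (suc (suc i)) , decode-c (suc i)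
  decode-onto (bottomEdge {v} v∈) = c 0 , v , bottomRed v∈ , decode-c 0 , decode-bottom v∈

  iso : ∀ {F} → F ⇔E Stage 0 → Iso F s (DE (c m)) (c m)
  iso F⇔ = iso-fromRetraction decode encode Vertex F⇔ (DE⇔ChainEdge m) (decode-c n)
             (inj₁ (n , ℕₚ.≤-refl , refl)) Stage0-ends encode-decode decode-edge decode-onto

  wd< : EditsInto s (DE s) (λ F → Iso F s (DE (c m)) (c m)) (fourHalf^ n₀)
  wd< = editsInto-map iso edits

-- Shortening a chain

-- After the shortcut c (k + 1) → c 0 is added, the nodes c 1, …, c k are deleted from the
-- bottom up, so that each of them is still reachable when its edges are removed.
module Shorten (b : Bool) (m₀ k₀ : ℕ) where
  open ChainGraph b

  m k n₀ n : ℕ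
  m  = suc m₀
  k  = suc k₀
  n₀ = k₀ + m
  n  = suc n₀

  s : Game
  s = c n

  k≤n₀ : k ≤ n₀
  k≤n₀ = subst (k ≤_) (sym (ℕₚ.+-suc k₀ m₀)) (ℕₚ.m≤m+n k m₀)

  depth≡ : ∀ {i r} → i + r ≡ k → n₀ ∸ i ≡ r + m₀
  depth≡ {i} {r} i+r≡k = begin
    n₀ ∸ i              ≡⟨ cong (_∸ i) (ℕₚ.+-suc k₀ m₀) ⟩
    (k + m₀) ∸ i        ≡⟨ cong (λ x → (x + m₀) ∸ i) (sym i+r≡k) ⟩
    (i + r + m₀) ∸ i    ≡⟨ cong (_∸ i) (ℕₚ.+-assoc i r m₀) ⟩
    (i + (r + m₀)) ∸ i  ≡⟨ ℕₚ.m+n∸m≡n i (r + m₀) ⟩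
    r + m₀              ∎
    where open ≡-Reasoning

  -- The graph once the shortcut is in place and the edges out of c 1, …, c i are gone.
  data Pruned (i : ℕ) : Color → Game → Game → Set where
    bottomBlue : Pruned i blue (c 0) zeroG
    keptBlue   : ∀ {j} → i < j → j ≤ n → Pruned i blue (c j) zeroG
    keptRed    : ∀ {j} → i ≤ j → suc j ≤ n → Pruned i red (c (suc j)) (c j)
    shortcut   : Pruned i red (c (suc k)) (c 0)
    bottomRed  : ∀ {v} → v ∈ bottom b → Pruned i red (c 0) v

  data Shortened : Color → Game → Game → Set where
    bottomBlue : Shortened blue (c 0) zeroG
    keptBlue   : ∀ {j} → k < j → j ≤ n → Shortened blue (c j) zeroG
    keptRed    : ∀ {j} → k < j → suc j ≤ n → Shortened red (c (suc j)) (c j)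
    shortcut   : Shortened red (c (suc k)) (c 0)
    bottomRed  : ∀ {v} → v ∈ bottom b → Shortened red (c 0) v

  Pruned-weaken : ∀ {i} → Pruned (suc i) ⊆E Pruned i
  Pruned-weaken bottomBlue          = bottomBlue
  Pruned-weaken (keptBlue i<j j≤n)  = keptBlue (ℕₚ.<-trans (ℕₚ.n<1+n _) i<j) j≤n
  Pruned-weaken (keptRed i≤j j<n)   = keptRed (ℕₚ.≤-trans (ℕₚ.n≤1+n _) i≤j) j<n
  Pruned-weaken shortcut            = shortcut
  Pruned-weaken (bottomRed v∈)      = bottomRed v∈

  Pruned⊆Pruned0 : ∀ i → Pruned i ⊆E Pruned 0
  Pruned⊆Pruned0 zero    edge = edge
  Pruned⊆Pruned0 (suc i) edge = Pruned⊆Pruned0 i (Pruned-weaken edge)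

  Pruned-init : addE (DE s) red (c (suc k)) (c 0) ⇔E Pruned 0
  Pruned-init = forth , back
    where
    forth : addE (DE s) red (c (suc k)) (c 0) ⊆E Pruned 0
    forth (inj₁ edge) with DE⊆ChainEdge {n} edge
    ... | blueEdge {zero} _     = bottomBlue
    ... | blueEdge {suc j} j≤n  = keptBlue (s≤s z≤n) j≤n
    ... | redEdge j<n           = keptRed z≤n j<n
    ... | bottomEdge v∈         = bottomRed v∈
    forth (inj₂ (refl , refl , refl)) = shortcut
    back : Pruned 0 ⊆E addE (DE s) red (c (suc k)) (c 0)
    back bottomBlue        = inj₁ (ChainEdge⊆DE {n} (blueEdge z≤n))
    back (keptBlue _ j≤n)  = inj₁ (ChainEdge⊆DE {n} (blueEdge j≤n))
    back (keptRed _ j<n)   = inj₁ (ChainEdge⊆DE {n} (redEdge j<n))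
    back shortcut          = inj₂ (refl , refl , refl)
    back (bottomRed v∈)    = inj₁ (ChainEdge⊆DE {n} (bottomEdge v∈))

  Pruned-step : ∀ {i E} → i < k → E ⇔E Pruned i →
                remE (remE E blue (c (suc i)) zeroG) red (c (suc i)) (c i) ⇔E Pruned (suc i)
  Pruned-step {i} {E} i<k (to , from) = forth , back
    where
    forth : remE (remE E blue (c (suc i)) zeroG) red (c (suc i)) (c i) ⊆E Pruned (suc i)
    forth ((edge , notBlue) , notRed) with to edge
    ... | bottomBlue = bottomBlue
    ... | keptBlue i<j j≤n with ℕₚ.m≤n⇒m<n∨m≡n i<j
    ...   | inj₁ 1+i<j = keptBlue 1+i<j j≤n
    ...   | inj₂ refl  = ⊥-elim (notBlue (refl , refl , refl))
    forth ((edge , notBlue) , notRed) | keptRed i≤j j<n with ℕₚ.m≤n⇒m<n∨m≡n i≤j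
    ...   | inj₁ i<j  = keptRed i<j j<n
    ...   | inj₂ refl = ⊥-elim (notRed (refl , refl , refl))
    forth ((edge , notBlue) , notRed) | shortcut      = shortcut
    forth ((edge , notBlue) , notRed) | bottomRed v∈  = bottomRed v∈
    back : Pruned (suc i) ⊆E remE (remE E blue (c (suc i)) zeroG) red (c (suc i)) (c i)
    back bottomBlue =
      (from bottomBlue , λ { (_ , c0≡ , _) → ℕₚ.0≢1+n (c-injective {0} {suc i} c0≡) }) , λ { (() , _) }
    back (keptBlue {j} 1+i<j j≤n) =
      (from (Pruned-weaken (keptBlue 1+i<j j≤n)) ,
       λ { (_ , cj≡ , _) → ℕₚ.<-irrefl (sym (c-injective {j} cj≡)) 1+i<j })
      , λ { (() , _) }
    back (keptRed {j} 1+i≤j j<n) =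
      (from (Pruned-weaken (keptRed 1+i≤j j<n)) , λ { (() , _) })
      , λ { (_ , c1+j≡ , _) → ℕₚ.<-irrefl (sym (ℕₚ.suc-injective (c-injective {suc j} c1+j≡))) 1+i≤j }
    back shortcut =
      (from shortcut , λ { (() , _) })
      , λ { (_ , c1+k≡ , _) → ℕₚ.<-irrefl (sym (ℕₚ.suc-injective (c-injective {suc k} c1+k≡))) i<k }
    back (bottomRed v∈) =
      (from (bottomRed v∈) , λ { (() , _) }) , λ { (_ , c0≡ , _) → ℕₚ.0≢1+n (c-injective {0} {suc i} c0≡) }

  Pruned-final : ∀ {E} → E ⇔E Pruned k → remE E red (c (suc k)) (c k) ⇔E Shortened
  Pruned-final {E} (to , from) = forth , back
    where
    forth : remE E red (c (suc k)) (c k) ⊆E Shortened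
    forth (edge , notLast) with to edge
    ... | bottomBlue        = bottomBlue
    ... | keptBlue k<j j≤n  = keptBlue k<j j≤n
    ... | keptRed k≤j j<n with ℕₚ.m≤n⇒m<n∨m≡n k≤j
    ...   | inj₁ k<j  = keptRed k<j j<n
    ...   | inj₂ refl = ⊥-elim (notLast (refl , refl , refl))
    forth (edge , notLast) | shortcut     = shortcut
    forth (edge , notLast) | bottomRed v∈ = bottomRed v∈
    back : Shortened ⊆E remE E red (c (suc k)) (c k)
    back bottomBlue          = from bottomBlue , λ { (() , _) }
    back (keptBlue k<j j≤n)  = from (keptBlue k<j j≤n) , λ { (() , _) }
    back (keptRed {j} k<j j<n) = from (keptRed (ℕₚ.<⇒≤ k<j) j<n) ,
      λ { (_ , c1+j≡ , _) → ℕₚ.<-irrefl (sym (ℕₚ.suc-injective (c-injective {suc j} c1+j≡))) k<j }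
    back shortcut            = from shortcut , λ { (_ , _ , c0≡ck) → ℕₚ.0≢1+n (c-injective {0} {k} c0≡ck) }
    back (bottomRed v∈)      = from (bottomRed v∈) , λ { (_ , c0≡ , _) → ℕₚ.0≢1+n (c-injective {0} {suc k} c0≡) }

  noShortcut : ∀ {col x y} → ChainEdge n col x y → x ≡ c (suc k) → y ≡ c 0 → ⊥
  noShortcut (blueEdge _)       _   ()
  noShortcut (redEdge {j} _)    x≡  y≡ with c-injective {j} {0} y≡
  ... | refl with c-injective {1} {suc k} x≡
  ...   | ()
  noShortcut (bottomEdge _)     x≡  _  = ℕₚ.0≢1+n (c-injective {0} {suc k} x≡)

  φ : Game → ℕ
  φ ⟨ [] ∣ _ ⟩      = 0
  φ ⟨ a ∷ as ∣ R ⟩  = chainDepth n (rank ⟨ a ∷ as ∣ R ⟩)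

  φ-c : ∀ j → φ (c j) ≡ chainDepth n j
  φ-c j = cong (chainDepth n) (rank-chain b j)

  Everything : EdgeSet
  Everything col x y = ChainEdge n col x y ⊎ Pruned 0 col x y

  open ChainPotential φ φ-c refl

  φ-potential : Potential Everything φ
  φ-potential (inj₁ edge)               = ChainEdge-potential edge
  φ-potential (inj₂ bottomBlue)          = z≤n
  φ-potential (inj₂ (keptBlue _ _))      = z≤n
  φ-potential (inj₂ (keptRed {j} _ _))   = φ-redStep j
  φ-potential (inj₂ shortcut)            = subst (_≤ suc (φ (c (suc k)))) (sym (φ-c 0)) z≤n
  φ-potential (inj₂ (bottomRed v∈))      = φ-zeroStep {c 0} (∈bottom⇒≡0 v∈)

  dist-c : ∀ {E} i r → i + r ≡ k → E ⊆E Everything →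
           (∀ {j} → i ≤ j → j < n₀ → E red (c (suc (suc j))) (c (suc j))) →
           Dist E s (c (suc i)) (r + m₀)
  dist-c {E} i r i+r≡k E⊆ redEdges = subst (Dist E s (c (suc i))) (depth≡ i+r≡k)
    (dist-byPotential {E} E⊆ φ-potential (trans (φ-c n) (ℕₚ.n∸n≡0 n₀))
      (path-down {E} n₀ (n₀ ∸ i) i (ℕₚ.m∸n+n≡m i≤n₀) redEdges) (φ-c (suc i)))
    where
    i≤n₀ : i ≤ n₀
    i≤n₀ = ℕₚ.≤-trans (subst (i ≤_) i+r≡k (ℕₚ.m≤m+n i r)) k≤n₀

  Pruned-redEdges : ∀ {i E} → Pruned i ⊆E E → ∀ {j} → i ≤ j → j < n₀ → E red (c (suc (suc j))) (c (suc j))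
  Pruned-redEdges from i≤j j<n₀ = from (keptRed (ℕₚ.≤-trans i≤j (ℕₚ.n≤1+n _)) (s≤s j<n₀))

  prune : ∀ r i → i + r ≡ k → ∀ {E} → E ⇔E Pruned i → EditsInto s E (_⇔E Shortened) (removalCost m₀ r)
  prune zero i i+0≡k {E} E⇔@(to , from) with trans (sym (ℕₚ.+-identityʳ i)) i+0≡k
  ... | refl =
    editsInto-weaken (ℚₚ.≤-reflexive (ℚₚ.+-identityʳ (half^ m₀)))
      (editsInto-rem (from (keptRed ℕₚ.≤-refl (s≤s k≤n₀)))
                     (dist-c {E} k 0 (ℕₚ.+-identityʳ k) (λ edge → inj₂ (Pruned⊆Pruned0 k (to edge)))
                        (Pruned-redEdges from))
      (editsInto-done (Pruned-final E⇔)))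
  prune (suc r) i i+1+r≡k {E} E⇔@(to , from) =
    editsInto-rem (from (keptBlue ℕₚ.≤-refl (s≤s i≤n₀)))
                  (dist-c {E} i (suc r) i+1+r≡k (λ edge → inj₂ (Pruned⊆Pruned0 i (to edge))) (Pruned-redEdges from))
    (editsInto-rem (from (keptRed ℕₚ.≤-refl (s≤s i≤n₀)) , λ { (() , _) })
                   (dist-c {E′} i (suc r) i+1+r≡k (λ edge → inj₂ (Pruned⊆Pruned0 i (to (proj₁ edge))))
                      (λ i≤j j<n₀ → Pruned-redEdges from i≤j j<n₀ , λ { (() , _) }))
    (prune r (suc i) (trans (sym (ℕₚ.+-suc i r)) i+1+r≡k) (Pruned-step i<k E⇔)))
    where
    E′ = remE E blue (c (suc i)) zeroG
    i<k : i < k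
    i<k = subst (i <_) i+1+r≡k (ℕₚ.m<m+n i (s≤s z≤n))
    i≤n₀ : i ≤ n₀
    i≤n₀ = ℕₚ.≤-trans (ℕₚ.<⇒≤ i<k) k≤n₀

  edits : EditsInto s (DE s) (_⇔E Shortened) (fourHalf^ m₀)
  edits =
    editsInto-weaken (half^+removalCost≤fourHalf^ m₀ k)
      (editsInto-add (λ edge → noShortcut {red} (DE⊆ChainEdge {n} edge) refl refl)
                     (dist-c {DE s} k 0 (ℕₚ.+-identityʳ k) (λ edge → inj₁ (DE⊆ChainEdge {n} edge))
                        (λ _ j<n₀ → ChainEdge⊆DE {n} (redEdge (s≤s j<n₀))))
      (prune k 0 refl Pruned-init))

  shift : ℕ → ℕ
  shift zero    = 0
  shift (suc j) = suc j + k

  unshift : ℕ → ℕ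
  unshift zero    = 0
  unshift (suc j) = suc j ∸ k

  decode : Game → Game
  decode ⟨ [] ∣ _ ⟩     = zeroG
  decode ⟨ a ∷ as ∣ R ⟩ = c (unshift (rank ⟨ a ∷ as ∣ R ⟩))

  encode : Game → Game
  encode ⟨ [] ∣ _ ⟩     = zeroG
  encode ⟨ a ∷ as ∣ R ⟩ = c (shift (rank ⟨ a ∷ as ∣ R ⟩))

  decode-c : ∀ j → decode (c j) ≡ c (unshift j)
  decode-c j = cong (c ∘ unshift) (rank-chain b j)

  decode-c+k : ∀ i → decode (c (suc i + k)) ≡ c (suc i)
  decode-c+k i = trans (decode-c (suc i + k)) (cong c (ℕₚ.m+n∸n≡m (suc i) k))

  decode-bottom : ∀ {v} → v ∈ bottom b → decode v ≡ v
  decode-bottom v∈ rewrite ∈bottom⇒≡0 v∈ = refl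

  encode-c : ∀ t → encode (c t) ≡ c (shift t)
  encode-c t = cong (c ∘ shift) (rank-chain b t)

  Vertex : Game → Set
  Vertex x = x ≡ c 0 ⊎ (∃ λ j → k < j × j ≤ n × x ≡ c j) ⊎ x ≡ zeroG

  encode-decode : ∀ {x} → Vertex x → encode (decode x) ≡ x
  encode-decode (inj₁ refl) = trans (cong encode (decode-c 0)) (encode-c 0)
  encode-decode (inj₂ (inj₁ (j , k<j , _ , refl))) with <⇒≡suc+ k<j
  ... | i , refl = trans (cong encode (decode-c+k i)) (encode-c (suc i))
  encode-decode (inj₂ (inj₂ refl)) = refl

  kept : ∀ {j} → k < j → j ≤ n → Vertex (c j)
  kept k<j j≤n = inj₂ (inj₁ (_ , k<j , j≤n , refl))

  Shortened-ends : ∀ {col x y} → Shortened col x y → Vertex x × Vertex y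
  Shortened-ends bottomBlue         = inj₁ refl , inj₂ (inj₂ refl)
  Shortened-ends (keptBlue k<j j≤n) = kept k<j j≤n , inj₂ (inj₂ refl)
  Shortened-ends (keptRed k<j j<n)  =
    kept (ℕₚ.≤-trans k<j (ℕₚ.n≤1+n _)) j<n , kept k<j (ℕₚ.≤-trans (ℕₚ.n≤1+n _) j<n)
  Shortened-ends shortcut           = kept ℕₚ.≤-refl (s≤s k≤n₀) , inj₁ refl
  Shortened-ends (bottomRed v∈) rewrite ∈bottom⇒≡0 v∈ = inj₁ refl , inj₂ (inj₂ refl)

  ≤m : ∀ {a} → a + k ≤ n → a ≤ m
  ≤m {a} a+k≤n = ℕₚ.+-cancelʳ-≤ k a m (subst (a + k ≤_) (ℕₚ.+-comm k m) a+k≤n)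

  ≤n : ∀ {a} → a ≤ m → a + k ≤ n
  ≤n {a} a≤m = subst (a + k ≤_) (ℕₚ.+-comm m k) (ℕₚ.+-monoˡ-≤ k a≤m)

  k<1+j+k : ∀ j → k < suc j + k
  k<1+j+k j = s≤s (ℕₚ.m≤n+m k j)

  decode-edge : ∀ {col x y} → Shortened col x y → ChainEdge m col (decode x) (decode y)
  decode-edge bottomBlue = subst (λ x → ChainEdge m blue x zeroG) (sym (decode-c 0)) (blueEdge z≤n)
  decode-edge (keptBlue k<j j≤n) with <⇒≡suc+ k<j
  ... | i , refl = subst (λ x → ChainEdge m blue x zeroG) (sym (decode-c+k i)) (blueEdge (≤m {suc i} j≤n))
  decode-edge (keptRed k<j j<n) with <⇒≡suc+ k<j
  ... | i , refl = subst₂ (ChainEdge m red) (sym (decode-c+k (suc i))) (sym (decode-c+k i)) (redEdge (≤m {suc (suc i)} j<n))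
  decode-edge shortcut = subst₂ (ChainEdge m red) (sym (decode-c+k 0)) (sym (decode-c 0)) (redEdge (s≤s z≤n))
  decode-edge (bottomRed v∈) = subst₂ (ChainEdge m red) (sym (decode-c 0)) (sym (decode-bottom v∈)) (bottomEdge v∈)

  decode-onto : ∀ {col x′ y′} → ChainEdge m col x′ y′ →
                ∃ λ x → ∃ λ y → Shortened col x y × decode x ≡ x′ × decode y ≡ y′
  decode-onto (blueEdge {zero} _)     = c 0 , zeroG , bottomBlue , decode-c 0 , refl
  decode-onto (blueEdge {suc j} j≤m)  = c (suc j + k) , zeroG , keptBlue (k<1+j+k j) (≤n j≤m) , decode-c+k j , refl
  decode-onto (redEdge {zero} _)      = c (suc k) , c 0 , shortcut , decode-c+k 0 , decode-c 0
  decode-onto (redEdge {suc j} j<m)   =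
    c (suc (suc j + k)) , c (suc j + k) , keptRed (k<1+j+k j) (≤n j<m) , decode-c+k (suc j) , decode-c+k j
  decode-onto (bottomEdge {v} v∈)     = c 0 , v , bottomRed v∈ , decode-c 0 , decode-bottom v∈

  iso : ∀ {F} → F ⇔E Shortened → Iso F s (DE (c m)) (c m)
  iso F⇔ = iso-fromRetraction decode encode Vertex F⇔ (DE⇔ChainEdge m)
             (trans (decode-c n) (cong c (ℕₚ.m+n∸m≡n k m)))
             (kept (s≤s k≤n₀) ℕₚ.≤-refl) Shortened-ends encode-decode decode-edge decode-onto

  wd> : EditsInto s (DE s) (λ F → Iso F s (DE (c m)) (c m)) (fourHalf^ m₀)
  wd> = editsInto-map iso edits

Iso-refl : ∀ G → Iso (DE G) G (DE G) G
Iso-refl G =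
  (λ x → x) , refl , (λ _ _ _ _ x≡y → x≡y) , (λ _ _ _ edge → edge) , λ _ x y edge → x , y , edge , refl , refl

wd-refl : ∀ {G ε} → 0ℚ <ℚ ε → WdLt G G ε
wd-refl {G} 0<ε = DE G , 0ℚ , done , Iso-refl G , 0<ε

wdLt-fromEditsInto : ∀ {G H B ε} → EditsInto G (DE G) (λ F → Iso F G (DE H) H) B → B <ℚ ε → WdLt G H ε
wdLt-fromEditsInto (F , q , edits , iso , q≤B) B<ε = F , q , edits , iso , ℚₚ.≤-<-trans q≤B B<ε

chain-wd< : ∀ b {ε} n₀ i → fourHalf^ n₀ <ℚ ε → WdLt (chain b (suc n₀)) (chain b (suc i + suc n₀)) ε
chain-wd< b {ε} n₀ i bound<ε =
  subst (λ j → WdLt (chain b (suc n₀)) (chain b j) ε) (ℕₚ.+-comm (suc n₀) (suc i))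
        (wdLt-fromEditsInto (Lengthen.wd< b n₀ i) bound<ε)

chain-wd> : ∀ b {ε} m₀ i → fourHalf^ m₀ <ℚ ε → WdLt (chain b (suc i + suc m₀)) (chain b (suc m₀)) ε
chain-wd> b m₀ i = wdLt-fromEditsInto (Shorten.wd> b m₀ i)

chain-cauchy : ∀ b → Cauchy (chain b)
chain-cauchy b ε 0<ε with half^<ε ε 0<ε
... | N , half^N<ε = suc (suc N) , close
  where
  small : ∀ {d} → suc (suc N) ≤ d → fourHalf^ d <ℚ ε
  small N+2≤d = ℚₚ.≤-<-trans (fourHalf^-antimono N+2≤d) (subst (_<ℚ ε) (sym (fourHalf^-+2 N)) half^N<ε)
  close : ∀ n m → suc (suc N) < n → suc (suc N) < m → WdLt (chain b n) (chain b m) ε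
  close n m _ _ with ℕₚ.<-cmp n m
  close n _ _ _ | tri≈ _ refl _ = wd-refl 0<ε
  close (suc n₀) m N<n _ | tri< n<m _ _ with <⇒≡suc+ n<m
  ... | i , refl = chain-wd< b n₀ i (small (ℕₚ.≤-pred N<n))
  close n (suc m₀) _ N<m | tri> _ _ m<n with <⇒≡suc+ m<n
  ... | i , refl = chain-wd> b m₀ i (small (ℕₚ.≤-pred N<m))

Cauchy-resp : ∀ {g h} → (∀ n → g n ≡ h n) → Cauchy h → Cauchy g
Cauchy-resp {g} g≡h h-cauchy ε 0<ε with h-cauchy ε 0<ε
... | N , close = N , λ n m N<n N<m →
  subst₂ (λ x y → WdLt x y ε) (sym (g≡h n)) (sym (g≡h m)) (close n m N<n N<m)

bSeq-isCanonSeqB : IsCanonSeqB bSeq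
bSeq-isCanonSeqB n = bSeq-canonical n , bSeq≈star⊕upStarTimes n

isCanonSeqB⇒≡bSeq : ∀ {b} → IsCanonSeqB b → ∀ n → b n ≡ bSeq n
isCanonSeqB⇒≡bSeq isB n =
  bSeq-uniqueCanonical n (proj₁ (isB n)) (≈g-trans (proj₂ (isB n)) (≈g-sym (bSeq≈star⊕upStarTimes n)))

mainTheorem2 : Cauchy dyadic
    × (∃ IsCanonSeqB)
    × (∀ b → IsCanonSeqB b → Cauchy b)
mainTheorem2 =
  Cauchy-resp dyadic≡chain (chain-cauchy false) ,
  (bSeq , bSeq-isCanonSeqB) ,
  λ b isB → Cauchy-resp (isCanonSeqB⇒≡bSeq isB) (chain-cauchy true)
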